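{- Let $x,y$ be elements of ${\bf FQSym}$ of positive degree that are primitive. Then $x\nearrow y-y\swarrow x$ is primitive.
   Context: Permutations are identified with words; for a word $w$ without repeated letters, ${\rm std}(w)$ is the permutation with the same relative order of letters. ${\bf FQSym}$ has basis $\mathbf G_\sigma$ ($\sigma$ over all permutations, including the empty one, $\mathbf G_\emptyset=1$). For $\alpha\in\mathfrak S_k,\beta\in\mathfrak S_l$, $n=k+l$, write $\gamma=uv\in\alpha\star\beta$ for the permutations $\gamma\in\mathfrak S_n$ written as a concatenation $uv$ with $|u|=k$, ${\rm std}(u)=\alpha$, ${\rm std}(v)=\beta$. The product is $\mathbf G_\alpha\mathbf G_\beta=\sum_{\gamma=uv\in\alpha\star\beta}\mathbf G_\gamma$ and the coproduct is $\Delta\mathbf G_\sigma=\sum_{i=0}^n\mathbf G_{\sigma|_{\{1..i\}}}\otimes\mathbf G_{{\rm std}(\sigma|_{\{i+1..n\}})}$, where $\sigma|_J$ is the subword of $\sigma$ made of letters in $J$. An element $x$ is primitive if $\Delta x=x\otimes1+1\otimes x$. For $k,l\ge1$ define bilinear products on the positive-degree part: $\mathbf G_\alpha\nearrow\mathbf G_\beta=\sum_{\gamma=uv\in\alpha\star\beta,\ 1\in u,\ n\in v}\mathbf G_\gamma$ and $\mathbf G_\alpha\swarrow\mathbf G_\beta=\sum_{\gamma=uv\in\alpha\star\beta,\ 1\in v,\ n\in u}\mathbf G_\gamma$ (here "$1\in u$" means the letter $1$ occurs in $u$). -}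

module Defs where

open import Level using (Level; _⊔_)
open import Algebra.Bundles using (CommutativeRing)
open import Data.Nat using (ℕ; zero; suc; _≤?_; _<?_; _≤_)
open import Data.List using (List; []; _∷_; map; concatMap; filter; upTo; length; take; drop; _++_; foldr)
open import Data.List.Properties using (≡-dec)
open import Data.List.Membership.DecPropositional (Data.Nat._≟_) using (_∈_; _∈?_)
open import Data.List.Relation.Binary.Permutation.Propositional using (_↭_)
open import Data.Product using (Σ; _×_; _,_; proj₁; proj₂)
open import Data.List.Relation.Unary.All using (All)
open import Relation.Nullary using (¬_; Dec; yes; no; does)
open import Relation.Nullary.Decidable using (_×-dec_; ¬?)
open import Relation.Binary.PropositionalEquality using (_≡_)
open import Data.Bool using (if_then_else_)

Word : Set
Word = List ℕ

one-to : ℕ → Word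
one-to n = map suc (upTo n)

IsPerm : Word → Set
IsPerm w = w ↭ one-to (length w)

Perm : Set
Perm = Σ Word IsPerm

countBelow : ℕ → Word → ℕ
countBelow a w = length (filter (_<? a) w)

-- standardization of a word without repeated letters
std : Word → Word
std w = map (λ a → suc (countBelow a w)) w

restrict≤ : ℕ → Word → Word
restrict≤ i σ = filter (_≤? i) σ

restrict> : ℕ → Word → Word
restrict> i σ = filter (λ a → ¬? (a ≤? i)) σ

insertions : ℕ → Word → List Word
insertions a []      = (a ∷ []) ∷ []
insertions a (b ∷ w) = (a ∷ b ∷ w) ∷ map (b ∷_) (insertions a w)

allPerms : ℕ → List Word
allPerms zero    = [] ∷ []
allPerms (suc n) = concatMap (insertions (suc n)) (allPerms n)

InStar : Word → Word → Word → Set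
InStar α β γ = (std (take (length α) γ) ≡ α) × (std (drop (length α) γ) ≡ β)

inStar? : ∀ α β γ → Dec (InStar α β γ)
inStar? α β γ = ≡-dec Data.Nat._≟_ (std (take (length α) γ)) α
           ×-dec ≡-dec Data.Nat._≟_ (std (drop (length α) γ)) β

InNE : Word → Word → Word → Set
InNE α β γ = InStar α β γ × ((1 ∈ take (length α) γ) × (length γ ∈ drop (length α) γ))

inNE? : ∀ α β γ → Dec (InNE α β γ)
inNE? α β γ = inStar? α β γ ×-dec ((1 ∈? take (length α) γ) ×-dec (length γ ∈? drop (length α) γ))

InSW : Word → Word → Word → Set
InSW α β γ = InStar α β γ × ((1 ∈ drop (length α) γ) × (length γ ∈ take (length α) γ))

inSW? : ∀ α β γ → Dec (InSW α β γ)
inSW? α β γ = inStar? α β γ ×-dec ((1 ∈? drop (length α) γ) ×-dec (length γ ∈? take (length α) γ))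

neWords : Word → Word → List Word
neWords α β = filter (inNE? α β) (allPerms (length α Data.Nat.+ length β))

swWords : Word → Word → List Word
swWords α β = filter (inSW? α β) (allPerms (length α Data.Nat.+ length β))

coprodTerms : Word → List (Word × Word)
coprodTerms σ = map (λ i → restrict≤ i σ , std (restrict> i σ)) (upTo (suc (length σ)))

-- FQSym over a commutative ring R, as formal finite linear combinations
-- of the basis elements G_σ; two elements are equal iff all their
-- coefficients agree.

module FQ {c ℓ : Level} (R : CommutativeRing c ℓ) where
  open CommutativeRing R renaming (Carrier to K)

  -- a list of terms (a, σ) represents Σ a · G_σ ; the words σ are required
  -- to be permutations (see WellFormed)
  FQSym : Set c
  FQSym = List (K × Word)

  WellFormed : FQSym → Set c
  WellFormed x = All (λ t → IsPerm (proj₂ t)) x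

  PositiveDegree : FQSym → Set c
  PositiveDegree x = All (λ t → 1 ≤ length (proj₂ t)) x

  -- FQSym ⊗ FQSym: lists of (a, σ, τ) representing Σ a · G_σ ⊗ G_τ
  FQSym⊗ : Set c
  FQSym⊗ = List (K × Word × Word)

  coeff : FQSym → Word → K
  coeff x σ = foldr (λ t r → if does (≡-dec Data.Nat._≟_ (proj₂ t) σ) then proj₁ t + r else r) 0# x

  coeff⊗ : FQSym⊗ → Word → Word → K
  coeff⊗ t σ τ = foldr (λ s r →
      if does (≡-dec Data.Nat._≟_ (proj₁ (proj₂ s)) σ ×-dec ≡-dec Data.Nat._≟_ (proj₂ (proj₂ s)) τ)
      then proj₁ s + r else r) 0# t

  _−_ : FQSym → FQSym → FQSym
  x − y = x ++ map (λ t → (- proj₁ t , proj₂ t)) y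

  -- bilinear extension of an operation on basis elements given by the list
  -- of words γ occurring (with coefficient 1) in G_α op G_β
  bilin : (Word → Word → List Word) → FQSym → FQSym → FQSym
  bilin f x y = concatMap (λ s → concatMap (λ t → map (λ γ → (proj₁ s * proj₁ t , γ)) (f (proj₂ s) (proj₂ t))) y) x

  _↗_ : FQSym → FQSym → FQSym
  _↗_ = bilin neWords

  _↙_ : FQSym → FQSym → FQSym
  _↙_ = bilin swWords

  Δ : FQSym → FQSym⊗
  Δ x = concatMap (λ s → map (λ p → (proj₁ s , p)) (coprodTerms (proj₂ s))) x

  -- x ⊗ 1 + 1 ⊗ x   (1 = G_∅)
  ⊗1+1⊗ : FQSym → FQSym⊗
  ⊗1+1⊗ x = map (λ s → (proj₁ s , proj₂ s , [])) x ++ map (λ s → (proj₁ s , [] , proj₂ s)) x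

  Primitive : FQSym → Set ℓ
  Primitive x = ∀ σ τ → coeff⊗ (Δ x) σ τ ≈ coeff⊗ (⊗1+1⊗ x) σ τ

-- Write a term of G_α G_β as γ = uv with |u| = |α|. If G_σ ⊗ G_τ occurs in Δ G_γ, then γ is a
-- shuffle of σ and of τ shifted by |σ|, and γ is recovered from the numbers j, j' of letters of σ
-- and of τ lying in u; such a γ exists exactly when G_std(σ₁…σⱼ) ⊗ G_std(τ₁…τⱼ') occurs in Δ G_α
-- and the complementary pair in Δ G_β (compatibility of product and coproduct, established by
-- counting permutations). For x ↗ y the conditions 1 ∈ u and n ∈ v imply j ≥ 1 and j' < |τ|, and
-- primitivity of x and y kills every such term except j = |σ|, j' = 0, which contributes x_σ y_τ.
-- Likewise y ↙ x contributes y_τ x_σ, so the two cancel in z = x ↗ y − y ↙ x. When σ or τ is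
-- empty, the coefficient agrees with that of z ⊗ 1 + 1 ⊗ z because all terms of z are nonempty
-- permutations.
module Submission where

open import Defs
open import Algebra.Bundles using (CommutativeRing)

module Lists where

  open import Data.Nat using (ℕ; zero; suc; _+_; _≤_; _<_; z≤n; s≤s)
  open import Data.Nat.Properties using (+-cancelˡ-≡; m≤m+n)
  open import Data.List using (List; []; _∷_; map; filter; take; drop; length; _++_)
  open import Data.List.Properties using (filter-++; length-++; take++drop≡id)
  open import Relation.Unary using (Pred; Decidable)
  open import Data.List.Membership.Propositional using (_∈_; _∉_)
  open import Data.List.Membership.Propositional.Properties using (∈-map⁺; ∈-map⁻; ∈-++⁺ˡ; ∈-++⁺ʳ; ∈-++⁻)
  open import Data.List.Relation.Binary.Permutation.Propositional using (_↭_; ↭-sym)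
  open import Data.List.Relation.Binary.Permutation.Propositional.Properties using (∈-resp-↭)
  open import Data.Sum using (inj₁; inj₂)
  open import Data.Product using (_,_)
  open import Function using (_∘_)
  open import Function.Bundles using (_⇔_; mk⇔)
  open import Relation.Binary.PropositionalEquality using (_≡_; _≢_; refl; cong; subst; sym; trans)
  open import Relation.Nullary using (contradiction)

  take-++-length : ∀ {a} {A : Set a} (X Y : List A) → take (length X) (X ++ Y) ≡ X
  take-++-length []      Y = refl
  take-++-length (x ∷ X) Y = cong (x ∷_) (take-++-length X Y)

  drop-++-length : ∀ {a} {A : Set a} (X Y : List A) → drop (length X) (X ++ Y) ≡ Y
  drop-++-length []      Y = refl
  drop-++-length (x ∷ X) Y = drop-++-length X Y

  module _ {a} {A : Set a} {x : A} {X Y Z : List A} (X↭ : X ↭ Y ++ Z) where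

    ∈-↭-++ˡ : x ∉ Z → x ∈ X ⇔ x ∈ Y
    ∈-↭-++ˡ x∉Z = mk⇔ to (∈-resp-↭ (↭-sym X↭) ∘ ∈-++⁺ˡ)
      where
      to : x ∈ X → x ∈ Y
      to x∈X with ∈-++⁻ Y (∈-resp-↭ X↭ x∈X)
      ... | inj₁ x∈Y = x∈Y
      ... | inj₂ x∈Z = contradiction x∈Z x∉Z

    ∈-↭-++ʳ : x ∉ Y → x ∈ X ⇔ x ∈ Z
    ∈-↭-++ʳ x∉Y = mk⇔ to (∈-resp-↭ (↭-sym X↭) ∘ ∈-++⁺ʳ Y)
      where
      to : x ∈ X → x ∈ Z
      to x∈X with ∈-++⁻ Y (∈-resp-↭ X↭ x∈X)
      ... | inj₁ x∈Y = contradiction x∈Y x∉Y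
      ... | inj₂ x∈Z = x∈Z

  ∈-map-+ : ∀ m {a} (w : List ℕ) → m + a ∈ map (m +_) w ⇔ a ∈ w
  ∈-map-+ m {a} w = mk⇔ to (∈-map⁺ (m +_))
    where
    to : m + a ∈ map (m +_) w → a ∈ w
    to i with ∈-map⁻ (m +_) i
    ... | c , c∈w , e = subst (_∈ w) (sym (+-cancelˡ-≡ m a c e)) c∈w

  length-filter-take : ∀ {a p} {A : Set a} {P : Pred A p} (P? : Decidable P) k (w : List A) →
    length (filter P? (take k w)) ≤ length (filter P? w)
  length-filter-take P? k w = subst (length (filter P? (take k w)) ≤_)
    (trans (sym (length-++ (filter P? (take k w)))) (cong length (trans (sym (filter-++ P? (take k w) _)) (cong (filter P?) (take++drop≡id k w)))))
    (m≤m+n _ _)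

  take-≢[] : ∀ {a} {A : Set a} {j} (w : List A) → 1 ≤ j → w ≢ [] → take j w ≢ []
  take-≢[] []      _       w≢[] = contradiction refl w≢[]
  take-≢[] (x ∷ w) (s≤s _) _    ()

  drop-≢[] : ∀ {a} {A : Set a} j (w : List A) → j < length w → drop j w ≢ []
  drop-≢[] zero    (x ∷ w) _         ()
  drop-≢[] (suc j) (x ∷ w) (s≤s j<) = drop-≢[] j w j<

  map-≢[] : ∀ {a b} {A : Set a} {B : Set b} (f : A → B) {w : List A} → w ≢ [] → map f w ≢ []
  map-≢[] f {[]}    w≢[] = contradiction refl w≢[]
  map-≢[] f {x ∷ w} _    ()

  ≢[]⇒1≤length : ∀ {a} {A : Set a} (w : List A) → w ≢ [] → 1 ≤ length w
  ≢[]⇒1≤length []      w≢[] = contradiction refl w≢[]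
  ≢[]⇒1≤length (x ∷ w) _    = s≤s z≤n

module SameOrder where

  open import Data.Nat using (ℕ; suc; _≤_; _<_; _<ᵇ_; z≤n; s≤s; s≤s⁻¹; _<?_)
  open import Data.Nat.Properties using (m≤n⇒m≤1+n; m<n⇒m<1+n; <-trans; <-≤-trans; <-irrefl; ≮⇒≥)
  open import Data.List using ([]; _∷_; map; filter; length)
  import Data.List.Relation.Binary.Pointwise as Pointwise
  open Pointwise using (Pointwise; []; _∷_)
  open import Data.List.Relation.Unary.Any using (here; there)
  open import Data.List.Membership.Propositional using (_∈_)
  open import Function using (_∘_)
  open import Function.Bundles using (mk⇔)
  open import Relation.Nullary using (¬_; yes; no; does)
  open import Relation.Nullary.Decidable using (does-⇔)
  open import Relation.Unary using (Pred; Decidable)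
  open import Relation.Binary.PropositionalEquality using (_≡_; refl; sym; trans; cong)
  open import Data.Empty using (⊥-elim)

  module _ {p q} {P : Pred ℕ p} {Q : Pred ℕ q} (P? : Decidable P) (Q? : Decidable Q) where

    filter⁺-agree : ∀ {r} {R : ℕ → ℕ → Set r} {w w' : Word} → Pointwise R w w' →
      Pointwise (λ a b → does (P? a) ≡ does (Q? b)) w w' → Pointwise R (filter P? w) (filter Q? w')
    filter⁺-agree [] [] = []
    filter⁺-agree {w = a ∷ _} {b ∷ _} (r ∷ rs) (e ∷ es) with P? a | Q? b
    ... | yes _ | yes _ = r ∷ filter⁺-agree rs es
    ... | no _  | no _  = filter⁺-agree rs es
    filter⁺-agree (r ∷ rs) (() ∷ es) | yes _ | no _
    filter⁺-agree (r ∷ rs) (() ∷ es) | no _  | yes _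

    length-filter-agree : {w w' : Word} → Pointwise (λ a b → does (P? a) ≡ does (Q? b)) w w' →
      length (filter P? w) ≡ length (filter Q? w')
    length-filter-agree agree = Pointwise.Pointwise-length (filter⁺-agree agree agree)

    length-filter-⊆ : ∀ w → (∀ {c} → c ∈ w → P c → Q c) → length (filter P? w) ≤ length (filter Q? w)
    length-filter-⊆ [] _ = z≤n
    length-filter-⊆ (c ∷ w) P⊆Q with P? c | Q? c
    ... | yes _  | yes _  = s≤s (length-filter-⊆ w (P⊆Q ∘ there))
    ... | no _   | yes _  = m≤n⇒m≤1+n (length-filter-⊆ w (P⊆Q ∘ there))
    ... | no _   | no _   = length-filter-⊆ w (P⊆Q ∘ there)
    ... | yes pc | no ¬qc = ⊥-elim (¬qc (P⊆Q (here refl) pc))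

    length-filter-⊂ : ∀ {a} w → (∀ {c} → c ∈ w → P c → Q c) → a ∈ w → Q a → ¬ P a →
      length (filter P? w) < length (filter Q? w)
    length-filter-⊂ (c ∷ w) P⊆Q (here refl) qc ¬pc with P? c | Q? c
    ... | yes pc | _      = ⊥-elim (¬pc pc)
    ... | no _   | yes _  = s≤s (length-filter-⊆ w (P⊆Q ∘ there))
    ... | no _   | no ¬qc = ⊥-elim (¬qc qc)
    length-filter-⊂ (c ∷ w) P⊆Q (there a∈w) qa ¬pa with P? c | Q? c
    ... | yes _  | yes _  = s≤s (length-filter-⊂ w (P⊆Q ∘ there) a∈w qa ¬pa)
    ... | no _   | yes _  = m<n⇒m<1+n (length-filter-⊂ w (P⊆Q ∘ there) a∈w qa ¬pa)
    ... | no _   | no _   = length-filter-⊂ w (P⊆Q ∘ there) a∈w qa ¬pa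
    ... | yes pc | no ¬qc = ⊥-elim (¬qc (P⊆Q (here refl) pc))

  Pointwise-mono-∈ : ∀ {r s} {R : ℕ → ℕ → Set r} {S : ℕ → ℕ → Set s} {w w' : Word} →
    (∀ {a b} → a ∈ w → b ∈ w' → R a b → S a b) → Pointwise R w w' → Pointwise S w w'
  Pointwise-mono-∈ f [] = []
  Pointwise-mono-∈ f (r ∷ rs) = f (here refl) (here refl) r ∷ Pointwise-mono-∈ (λ i j → f (there i) (there j)) rs

  Pointwise-graph : ∀ {s} {S : ℕ → ℕ → Set s} (g : ℕ → ℕ) (w : Word) →
    (∀ a → a ∈ w → S a (g a)) → Pointwise S w (map g w)
  Pointwise-graph g [] f = []
  Pointwise-graph g (a ∷ w) f = f a (here refl) ∷ Pointwise-graph g w (λ b → f b ∘ there)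

  Pointwise-refl-∈ : ∀ {s} {S : ℕ → ℕ → Set s} (w : Word) → (∀ a → a ∈ w → S a a) → Pointwise S w w
  Pointwise-refl-∈ [] f = []
  Pointwise-refl-∈ (a ∷ w) f = f a (here refl) ∷ Pointwise-refl-∈ w (λ b → f b ∘ there)

  rank : Word → ℕ → ℕ
  rank w a = suc (countBelow a w)

  countBelow-mono : ∀ {a b} w → a ≤ b → countBelow a w ≤ countBelow b w
  countBelow-mono w a≤b = length-filter-⊆ (_<? _) (_<? _) w (λ _ c<a → <-≤-trans c<a a≤b)

  rank-<ᵇ : ∀ w {a b} → a ∈ w → (a <ᵇ b) ≡ (rank w a <ᵇ rank w b)
  rank-<ᵇ w {a} {b} a∈w = does-⇔ (mk⇔ preserve reflect) (a <? b) (rank w a <? rank w b)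
    where
    preserve : a < b → rank w a < rank w b
    preserve a<b = s≤s (length-filter-⊂ (_<? a) (_<? b) w (λ _ c<a → <-trans c<a a<b) a∈w a<b (<-irrefl refl))
    reflect : rank w a < rank w b → a < b
    reflect r with a <? b
    ... | yes a<b = a<b
    ... | no a≮b = ⊥-elim (<-irrefl refl (<-≤-trans (s≤s⁻¹ r) (countBelow-mono w (≮⇒≥ a≮b))))

  -- a is placed among the letters of w as b is among those of w'
  SameComparisons : Word → Word → ℕ → ℕ → Set
  SameComparisons w w' a b = Pointwise (λ a' b' → (a' <ᵇ a) ≡ (b' <ᵇ b)) w w'

  SameOrder : Word → Word → Set
  SameOrder w w' = Pointwise (SameComparisons w w') w w'

  std-resp-SameOrder : ∀ {w w'} → SameOrder w w' → std w ≡ std w'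
  std-resp-SameOrder {w} {w'} same = Pointwise.Pointwise-≡⇒≡ (Pointwise.map⁺ (rank w) (rank w')
    (Pointwise.map (cong suc ∘ length-filter-agree (_<? _) (_<? _)) same))

  SameOrder-std : ∀ w → SameOrder w (std w)
  SameOrder-std w = Pointwise-graph (rank w) w (λ a _ → Pointwise-graph (rank w) w (λ a' a'∈w → rank-<ᵇ w a'∈w))

  SameOrder-sym : ∀ {w w'} → SameOrder w w' → SameOrder w' w
  SameOrder-sym = Pointwise.symmetric (Pointwise.symmetric sym)

  SameOrder-trans : ∀ {w w' w''} → SameOrder w w' → SameOrder w' w'' → SameOrder w w''
  SameOrder-trans = Pointwise.transitive (Pointwise.transitive trans)

  SameOrder-map : ∀ (f : ℕ → ℕ) w → (∀ a b → a ∈ w → b ∈ w → (a <ᵇ b) ≡ (f a <ᵇ f b)) → SameOrder w (map f w)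
  SameOrder-map f w mono = Pointwise-graph f w (λ a a∈w → Pointwise-graph f w (λ a' a'∈w → mono a' a a'∈w a∈w))

  SameOrder-filter : ∀ {p q} {P : Pred ℕ p} {Q : Pred ℕ q} (P? : Decidable P) (Q? : Decidable Q) {w w'} →
    SameOrder w w' → Pointwise (λ a b → does (P? a) ≡ does (Q? b)) w w' → SameOrder (filter P? w) (filter Q? w')
  SameOrder-filter P? Q? same agree = filter⁺-agree P? Q? (Pointwise.map (λ r → filter⁺-agree P? Q? r agree) same) agree

module Intervals where

  open SameOrder
  open import Data.Nat using (zero; suc; _+_; _∸_; _≤_; _<_; _<ᵇ_; z≤n; s≤s; s≤s⁻¹; _≤?_; _<?_)
  open import Data.Nat.Properties
  open import Data.List using ([]; map; length; _++_; upTo; [_])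
  open import Data.List.Properties
    using (length-map; length-upTo; filter-++; filter-all; filter-none; ++-assoc; ++-identityʳ; map-++; map-id; map-id-local; map-∘; map-cong; map-cong-local; upTo-∷ʳ)
  import Data.List.Relation.Binary.Pointwise as Pointwise
  import Data.List.Relation.Unary.All as All
  open import Data.List.Membership.Propositional using (_∈_)
  open import Data.List.Membership.Propositional.Properties using (∈-map⁺; ∈-map⁻; ∈-upTo⁺; ∈-upTo⁻)
  open import Data.List.Relation.Binary.Permutation.Propositional using (_↭_; ↭-trans; ↭-reflexive)
  open import Data.List.Relation.Binary.Permutation.Propositional.Properties using (filter-↭; ↭-length; ∈-resp-↭; map⁺)
  open import Data.Product using (_×_; _,_; proj₁; proj₂)
  open import Function using (_∘_)
  open import Function.Bundles using (mk⇔)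
  open import Relation.Nullary.Decidable using (does-⇔)
  open import Relation.Nullary using (contradiction)
  open import Relation.Binary.PropositionalEquality hiding ([_])
  open ≡-Reasoning

  one-to-suc : ∀ n → one-to (suc n) ≡ one-to n ++ [ suc n ]
  one-to-suc n = trans (cong (map suc) (sym (upTo-∷ʳ n))) (map-++ suc (upTo n) [ n ])

  ∈-one-to⁻ : ∀ {a} n → a ∈ one-to n → 1 ≤ a × a ≤ n
  ∈-one-to⁻ n a∈ with ∈-map⁻ suc a∈
  ... | _ , b∈ , refl = s≤s z≤n , ∈-upTo⁻ b∈

  ∈-one-to⁺ : ∀ {a} n → 1 ≤ a → a ≤ n → a ∈ one-to n
  ∈-one-to⁺ {suc b} n _ b<n = ∈-map⁺ suc (∈-upTo⁺ b<n)

  length-one-to : ∀ n → length (one-to n) ≡ n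
  length-one-to n = trans (length-map suc (upTo n)) (length-upTo n)

  shifted-above : ∀ m {w : Word} → (∀ {c} → c ∈ w → 1 ≤ c) → ∀ {a} → a ∈ map (m +_) w → m < a
  shifted-above m pos a∈ with ∈-map⁻ (m +_) a∈
  ... | c , c∈ , refl = subst (_≤ m + c) (+-comm m 1) (+-monoʳ-≤ m (pos c∈))

  one-to-++ : ∀ m p → one-to m ++ map (m +_) (one-to p) ≡ one-to (m + p)
  one-to-++ m zero = trans (++-identityʳ (one-to m)) (cong one-to (sym (+-identityʳ m)))
  one-to-++ m (suc p) = begin
      one-to m ++ map (m +_) (one-to (suc p))
    ≡⟨ cong (λ w → one-to m ++ map (m +_) w) (one-to-suc p) ⟩
      one-to m ++ map (m +_) (one-to p ++ [ suc p ])
    ≡⟨ cong (one-to m ++_) (map-++ (m +_) (one-to p) [ suc p ]) ⟩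
      one-to m ++ (map (m +_) (one-to p) ++ [ m + suc p ])
    ≡⟨ sym (++-assoc (one-to m) _ _) ⟩
      (one-to m ++ map (m +_) (one-to p)) ++ [ m + suc p ]
    ≡⟨ cong₂ (λ w a → w ++ [ a ]) (one-to-++ m p) (+-suc m p) ⟩
      one-to (m + p) ++ [ suc (m + p) ]
    ≡⟨ sym (one-to-suc (m + p)) ⟩
      one-to (suc (m + p))
    ≡⟨ cong one-to (sym (+-suc m p)) ⟩
      one-to (m + suc p) ∎

  one-to-split : ∀ {j n} → j ≤ n → one-to n ≡ one-to j ++ map (j +_) (one-to (n ∸ j))
  one-to-split {j} {n} j≤n = trans (cong one-to (sym (m+[n∸m]≡n j≤n))) (sym (one-to-++ j (n ∸ j)))

  private
    one-to-below : ∀ j → All.All (_≤ j) (one-to j)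
    one-to-below j = All.tabulate (proj₂ ∘ ∈-one-to⁻ j)

    shifted-one-to-above : ∀ j d → All.All (j <_) (map (j +_) (one-to d))
    shifted-one-to-above j d = All.tabulate (shifted-above j (proj₁ ∘ ∈-one-to⁻ d))

  restrict≤-one-to : ∀ {j n} → j ≤ n → restrict≤ j (one-to n) ≡ one-to j
  restrict≤-one-to {j} {n} j≤n = begin
      restrict≤ j (one-to n)
    ≡⟨ cong (restrict≤ j) (one-to-split j≤n) ⟩
      restrict≤ j (one-to j ++ map (j +_) (one-to (n ∸ j)))
    ≡⟨ filter-++ (_≤? j) (one-to j) _ ⟩
      restrict≤ j (one-to j) ++ restrict≤ j (map (j +_) (one-to (n ∸ j)))
    ≡⟨ cong₂ _++_ (filter-all (_≤? j) (one-to-below j))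
                  (filter-none (_≤? j) (All.map <⇒≱ (shifted-one-to-above j (n ∸ j)))) ⟩
      one-to j ++ []
    ≡⟨ ++-identityʳ (one-to j) ⟩
      one-to j ∎

  restrict>-one-to : ∀ {j n} → j ≤ n → restrict> j (one-to n) ≡ map (j +_) (one-to (n ∸ j))
  restrict>-one-to {j} {n} j≤n = begin
      restrict> j (one-to n)
    ≡⟨ cong (restrict> j) (one-to-split j≤n) ⟩
      restrict> j (one-to j ++ map (j +_) (one-to (n ∸ j)))
    ≡⟨ filter-++ _ (one-to j) _ ⟩
      restrict> j (one-to j) ++ restrict> j (map (j +_) (one-to (n ∸ j)))
    ≡⟨ cong₂ _++_ (filter-none _ (All.map (λ a≤j a≰j → a≰j a≤j) (one-to-below j)))
                  (filter-all _ (All.map <⇒≱ (shifted-one-to-above j (n ∸ j)))) ⟩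
      map (j +_) (one-to (n ∸ j)) ∎

  restrict≤-↭ : ∀ {n γ i} → γ ↭ one-to n → i ≤ n → restrict≤ i γ ↭ one-to i
  restrict≤-↭ π i≤n = ↭-trans (filter-↭ _ π) (↭-reflexive (restrict≤-one-to i≤n))

  restrict>-↭ : ∀ {n γ i} → γ ↭ one-to n → i ≤ n → restrict> i γ ↭ map (i +_) (one-to (n ∸ i))
  restrict>-↭ π i≤n = ↭-trans (filter-↭ _ π) (↭-reflexive (restrict>-one-to i≤n))

  length-↭-one-to : ∀ {n W} → W ↭ one-to n → length W ≡ n
  length-↭-one-to {n} π = trans (↭-length π) (length-one-to n)

  length-restrict>-↭ : ∀ {n γ i} → γ ↭ one-to n → i ≤ n → length (restrict> i γ) ≡ n ∸ i
  length-restrict>-↭ {n} {i = i} π i≤n = trans (↭-length (restrict>-↭ π i≤n)) (trans (length-map (i +_) (one-to (n ∸ i))) (length-one-to (n ∸ i)))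

  countBelow-one-to : ∀ {a n} → a ≤ n → countBelow (suc a) (one-to n) ≡ a
  countBelow-one-to {a} {n} a≤n = begin
      countBelow (suc a) (one-to n)
    ≡⟨ length-filter-agree (_<? suc a) (_≤? a)
         (Pointwise-refl-∈ (one-to n) (λ b _ → does-⇔ (mk⇔ s≤s⁻¹ s≤s) (b <? suc a) (b ≤? a))) ⟩
      length (restrict≤ a (one-to n))
    ≡⟨ cong length (restrict≤-one-to a≤n) ⟩
      length (one-to a)
    ≡⟨ length-one-to a ⟩
      a ∎

  <ᵇ-+ˡ : ∀ m a b → (a <ᵇ b) ≡ (m + a <ᵇ m + b)
  <ᵇ-+ˡ m a b = does-⇔ (mk⇔ (+-monoʳ-< m) (+-cancelˡ-< m a b)) (a <? b) (m + a <? m + b)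

  countBelow-shift : ∀ m b w → countBelow (m + b) (map (m +_) w) ≡ countBelow b w
  countBelow-shift m b w = length-filter-agree (_<? m + b) (_<? b)
    (Pointwise.symmetric sym (Pointwise-graph (m +_) w (λ a _ → <ᵇ-+ˡ m a b)))

  std-shift : ∀ m w → std (map (m +_) w) ≡ std w
  std-shift m w = sym (std-resp-SameOrder (SameOrder-map (m +_) w (λ a b _ _ → <ᵇ-+ˡ m a b)))

  std-shifted : ∀ m p (w : Word) → w ↭ map (m +_) (one-to p) → std w ≡ map (_∸ m) w
  std-shifted m p w π = map-cong-local (All.tabulate rank≡)
    where
    rank-shifted : ∀ {c} → c ∈ one-to p → rank w (m + c) ≡ m + c ∸ m
    rank-shifted {zero} c∈ = contradiction (proj₁ (∈-one-to⁻ p c∈)) λ ()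
    rank-shifted {suc b} c∈ = begin
        suc (countBelow (m + suc b) w)
      ≡⟨ cong suc (↭-length (filter-↭ (_<? m + suc b) π)) ⟩
        suc (countBelow (m + suc b) (map (m +_) (one-to p)))
      ≡⟨ cong suc (countBelow-shift m (suc b) (one-to p)) ⟩
        suc (countBelow (suc b) (one-to p))
      ≡⟨ cong suc (countBelow-one-to (<⇒≤ (proj₂ (∈-one-to⁻ p c∈)))) ⟩
        suc b
      ≡⟨ sym (m+n∸m≡n m (suc b)) ⟩
        m + suc b ∸ m ∎
    rank≡ : ∀ {a} → a ∈ w → rank w a ≡ a ∸ m
    rank≡ a∈w with ∈-map⁻ (m +_) (∈-resp-↭ π a∈w)
    ... | c , c∈ , refl = rank-shifted c∈

  map-shift-std-shifted : ∀ m p (w : Word) → w ↭ map (m +_) (one-to p) → map (m +_) (std w) ≡ w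
  map-shift-std-shifted m p w π = begin
      map (m +_) (std w)
    ≡⟨ cong (map (m +_)) (std-shifted m p w π) ⟩
      map (m +_) (map (_∸ m) w)
    ≡⟨ sym (map-∘ w) ⟩
      map (λ a → m + (a ∸ m)) w
    ≡⟨ map-id-local (All.tabulate (λ a∈w → m+[n∸m]≡n (<⇒≤ (above a∈w)))) ⟩
      w ∎
    where
    above : ∀ {a} → a ∈ w → m < a
    above a∈w = shifted-above m (proj₁ ∘ ∈-one-to⁻ p) (∈-resp-↭ π a∈w)

  std-shifted-↭ : ∀ m p (w : Word) → w ↭ map (m +_) (one-to p) → std w ↭ one-to p
  std-shifted-↭ m p w π = subst (_↭ one-to p) (sym (std-shifted m p w π)) (↭-trans (map⁺ (_∸ m) π) (↭-reflexive (begin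
      map (_∸ m) (map (m +_) (one-to p))
    ≡⟨ sym (map-∘ (one-to p)) ⟩
      map (λ a → m + a ∸ m) (one-to p)
    ≡⟨ map-cong (m+n∸m≡n m) (one-to p) ⟩
      map (λ a → a) (one-to p)
    ≡⟨ map-id (one-to p) ⟩
      one-to p ∎)))

  std-perm : ∀ {n} (w : Word) → w ↭ one-to n → std w ≡ w
  std-perm {n} w π = trans (std-shifted 0 n w (subst (w ↭_) (sym (map-id (one-to n))) π)) (map-id w)

module Merge where

  open SameOrder
  open Intervals
  open import Data.Bool using (Bool; true; false; not; if_then_else_)
  open import Data.Nat using (ℕ; suc; _≤_; _<_; _<ᵇ_; _≤?_; _<?_)
  open import Data.Nat.Properties using (suc-injective; ≤-trans; <-trans; <-≤-trans; ≤-<-trans; <⇒≤; <-irrefl; ≰⇒>)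
  open import Data.List using ([]; _∷_; map; filter; length; drop; _++_)
  open import Data.List.Properties using (length-map; length-filter)
  import Data.List.Relation.Binary.Pointwise as Pointwise
  open Pointwise using (Pointwise; []; _∷_)
  open import Data.List.Relation.Unary.Any using (here; there)
  open import Data.List.Membership.Propositional using (_∈_)
  import Data.List.Relation.Unary.All as All
  open All using (All)
  open import Data.List.Membership.Propositional.Properties using (∈-filter⁻)
  open import Data.List.Relation.Binary.Permutation.Propositional using (_↭_; ↭-sym; ↭-trans; ↭-refl; ↭-prep)
  open import Data.List.Relation.Binary.Permutation.Propositional.Properties using (shift)
  open import Data.Product using (_×_; _,_; proj₂)
  open import Function using (_∘_)
  open import Function.Bundles using (mk⇔)
  open import Relation.Nullary using (¬_; yes; no; does)
  open import Relation.Nullary.Decidable using (¬?; dec-false; dec-true; does-⇔)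
  open import Relation.Unary using (Pred; Decidable)
  open import Relation.Binary.PropositionalEquality
  open import Data.Empty using (⊥-elim)

  private
    hd : Word → ℕ
    hd [] = 0
    hd (a ∷ _) = a

  -- Each letter a of the pattern π is replaced by the next unused letter of A if t a, of B otherwise
  -- (by 0 once that list is used up: the lemmas below assume |A| and |B| match π).
  mergeBy : (ℕ → Bool) → Word → Word → Word → Word
  mergeBy t [] A B = []
  mergeBy t (a ∷ π) A B = if t a then hd A ∷ mergeBy t π (drop 1 A) B else hd B ∷ mergeBy t π A (drop 1 B)

  length-mergeBy : ∀ t π A B → length (mergeBy t π A B) ≡ length π
  length-mergeBy t [] A B = refl
  length-mergeBy t (a ∷ π) A B with t a
  ... | true  = cong suc (length-mergeBy t π (drop 1 A) B)
  ... | false = cong suc (length-mergeBy t π A (drop 1 B))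

  mergeBy-cong : ∀ (t t' : ℕ → Bool) {π π'} A B → Pointwise (λ a b → t a ≡ t' b) π π' →
    mergeBy t π A B ≡ mergeBy t' π' A B
  mergeBy-cong t t' A B [] = refl
  mergeBy-cong t t' {a ∷ _} {b ∷ _} A B (e ∷ es) with t a | t' b
  ... | true  | true  = cong (hd A ∷_) (mergeBy-cong t t' (drop 1 A) B es)
  ... | false | false = cong (hd B ∷_) (mergeBy-cong t t' A (drop 1 B) es)
  mergeBy-cong t t' A B (() ∷ _) | true  | false
  mergeBy-cong t t' A B (() ∷ _) | false | true

  module _ {p} {P : Pred ℕ p} (P? : Decidable P) where

    private
      t : ℕ → Bool
      t a = does (P? a)

    mergeBy-filter : ∀ u → mergeBy t u (filter P? u) (filter (¬? ∘ P?) u) ≡ u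
    mergeBy-filter [] = refl
    mergeBy-filter (a ∷ u) with P? a
    ... | yes _ = cong (a ∷_) (mergeBy-filter u)
    ... | no _  = cong (a ∷_) (mergeBy-filter u)

    mergeBy-Pointwise : ∀ {r} {R : ℕ → ℕ → Set r} π {A B} → Pointwise R A (filter P? π) →
      Pointwise R B (filter (¬? ∘ P?) π) → Pointwise R (mergeBy t π A B) π
    mergeBy-Pointwise [] _ _ = []
    mergeBy-Pointwise (a ∷ π) rA rB with P? a
    mergeBy-Pointwise (a ∷ π) (r ∷ rA) rB | yes _ = r ∷ mergeBy-Pointwise π rA rB
    mergeBy-Pointwise (a ∷ π) rA (r ∷ rB) | no _  = r ∷ mergeBy-Pointwise π rA rB

    mergeBy-↭ : ∀ π A B → length A ≡ length (filter P? π) → length B ≡ length (filter (¬? ∘ P?) π) →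
      mergeBy t π A B ↭ A ++ B
    mergeBy-↭ [] [] [] _ _ = ↭-refl
    mergeBy-↭ (a ∷ π) A B eA eB with P? a
    mergeBy-↭ (a ∷ π) (x ∷ A) B eA eB | yes _ = ↭-prep x (mergeBy-↭ π A B (suc-injective eA) eB)
    mergeBy-↭ (a ∷ π) A (y ∷ B) eA eB | no _ =
      ↭-trans (↭-prep y (mergeBy-↭ π A B eA (suc-injective eB))) (↭-sym (shift y A B))

    filter-mergeBy : ∀ {q} {Q : Pred ℕ q} (Q? : Decidable Q) π A B →
      length A ≡ length (filter P? π) → length B ≡ length (filter (¬? ∘ P?) π) →
      (∀ x → x ∈ A → Q x) → (∀ y → y ∈ B → ¬ Q y) →
      filter Q? (mergeBy t π A B) ≡ A × filter (¬? ∘ Q?) (mergeBy t π A B) ≡ B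
    filter-mergeBy Q? [] [] [] _ _ _ _ = refl , refl
    filter-mergeBy Q? (a ∷ π) A B eA eB inA inB with P? a
    filter-mergeBy Q? (a ∷ π) (x ∷ A) B eA eB inA inB | yes _
      with Q? x | filter-mergeBy Q? π A B (suc-injective eA) eB (λ z → inA z ∘ there) inB
    ... | yes _  | (eq₁ , eq₂) = cong (x ∷_) eq₁ , eq₂
    ... | no ¬qx | _           = ⊥-elim (¬qx (inA x (here refl)))
    filter-mergeBy Q? (a ∷ π) A (y ∷ B) eA eB inA inB | no _
      with Q? y | filter-mergeBy Q? π A B eA (suc-injective eB) inA (λ z → inB z ∘ there)
    ... | no _  | (eq₁ , eq₂) = eq₁ , cong (y ∷_) eq₂
    ... | yes qy | _          = ⊥-elim (inB y (here refl) qy)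

  Pointwise-all : ∀ {r} {R : ℕ → ℕ → Set r} (X Y : Word) → length X ≡ length Y →
    (∀ a b → a ∈ X → b ∈ Y → R a b) → Pointwise R X Y
  Pointwise-all [] [] _ _ = []
  Pointwise-all (a ∷ X) (b ∷ Y) e R-all =
    R-all a b (here refl) (here refl) ∷ Pointwise-all X Y (suc-injective e) (λ a' b' i j → R-all a' b' (there i) (there j))

  std-threshold : ∀ m u → Pointwise (λ a b → does (a ≤? m) ≡ does (b ≤? length (restrict≤ m u))) u (std u)
  std-threshold m u = Pointwise-graph (rank u) u (λ a a∈u → does-⇔ (mk⇔ (preserve a∈u) reflect) (a ≤? m) (rank u a ≤? j))
    where
    j = length (restrict≤ m u)
    preserve : ∀ {a} → a ∈ u → a ≤ m → rank u a ≤ j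
    preserve a∈u a≤m = length-filter-⊂ (_<? _) (_≤? m) u (λ _ c<a → ≤-trans (<⇒≤ c<a) a≤m) a∈u a≤m (<-irrefl refl)
    reflect : ∀ {a} → rank u a ≤ j → a ≤ m
    reflect {a} r with a ≤? m
    ... | yes a≤m = a≤m
    ... | no a≰m  = ⊥-elim (<-irrefl refl (<-≤-trans r
            (length-filter-⊆ (_≤? m) (_<? a) u (λ _ c≤m → ≤-<-trans c≤m (≰⇒> a≰m)))))

  split-block : ∀ {m j} u {α A B} → std u ≡ α → IsPerm α → restrict≤ m u ≡ A → restrict> m u ≡ B → length A ≡ j →
    restrict≤ j α ≡ std A × std (restrict> j α) ≡ std B × u ≡ mergeBy (λ a → does (a ≤? j)) α A B
  split-block {m} u refl π refl refl refl = sym std-restrict≤ , sym std-restrict> , mergeBy-restrict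
    where
    j = length (restrict≤ m u)

    std-restrict≤ : std (restrict≤ m u) ≡ restrict≤ j (std u)
    std-restrict≤ = trans (std-resp-SameOrder (SameOrder-filter (_≤? m) (_≤? j) (SameOrder-std u) (std-threshold m u)))
      (std-perm (restrict≤ j (std u)) (restrict≤-↭ π (subst (j ≤_) (sym (length-map (rank u) u)) (length-filter (_≤? m) u))))

    std-restrict> : std (restrict> m u) ≡ std (restrict> j (std u))
    std-restrict> = std-resp-SameOrder (SameOrder-filter _ _ (SameOrder-std u) (Pointwise.map (cong not) (std-threshold m u)))

    mergeBy-restrict : u ≡ mergeBy (λ a → does (a ≤? j)) (std u) (restrict≤ m u) (restrict> m u)
    mergeBy-restrict = trans (sym (mergeBy-filter (_≤? m) u)) (mergeBy-cong _ _ _ _ (std-threshold m u))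

  -- Conversely, a block with pattern α can be assembled from its low part A and its high part B.
  module MergeBlock (m j : ℕ) (α A B : Word)
    (std-A : std A ≡ restrict≤ j α) (std-B : std B ≡ std (restrict> j α))
    (A-low : All (_≤ m) A) (B-high : All (m <_) B) where

    merged : Word
    merged = mergeBy (λ a → does (a ≤? j)) α A B

    private
      length-A : length A ≡ length (restrict≤ j α)
      length-A = trans (sym (length-map (rank A) A)) (cong length std-A)

      length-B : length B ≡ length (restrict> j α)
      length-B = trans (sym (length-map (rank B) B)) (trans (cong length std-B) (length-map _ (restrict> j α)))

      below-j : ∀ {b} → b ∈ restrict≤ j α → b ≤ j
      below-j = proj₂ ∘ ∈-filter⁻ (_≤? j) {xs = α}

      above-j : ∀ {b} → b ∈ restrict> j α → j < b
      above-j = ≰⇒> ∘ proj₂ ∘ ∈-filter⁻ (¬? ∘ (_≤? j)) {xs = α}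

      not-<ᵇ : ∀ {a b} → b < a → (a <ᵇ b) ≡ false
      not-<ᵇ b<a = dec-false (_ <? _) (λ a<b → <-irrefl refl (<-trans a<b b<a))

      lift-A : ∀ {x y} → x ∈ A → y ∈ restrict≤ j α → SameComparisons A (restrict≤ j α) x y → SameComparisons merged α x y
      lift-A x∈A y∈L same = mergeBy-Pointwise (_≤? j) α same
        (Pointwise-all B (restrict> j α) length-B (λ a b a∈B b∈H →
          trans (not-<ᵇ (≤-<-trans (All.lookup A-low x∈A) (All.lookup B-high a∈B))) (sym (not-<ᵇ (≤-<-trans (below-j y∈L) (above-j b∈H))))))

      lift-B : ∀ {x y} → x ∈ B → y ∈ restrict> j α → SameComparisons B (restrict> j α) x y → SameComparisons merged α x y
      lift-B x∈B y∈H same = mergeBy-Pointwise (_≤? j) α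
        (Pointwise-all A (restrict≤ j α) length-A (λ a b a∈A b∈L →
          trans (dec-true (_ <? _) (≤-<-trans (All.lookup A-low a∈A) (All.lookup B-high x∈B)))
                (sym (dec-true (_ <? _) (≤-<-trans (below-j b∈L) (above-j y∈H))))))
        same

      SameOrder-A : SameOrder A (restrict≤ j α)
      SameOrder-A = subst (SameOrder A) std-A (SameOrder-std A)

      SameOrder-B : SameOrder B (restrict> j α)
      SameOrder-B = SameOrder-trans (SameOrder-std B)
        (subst (λ w → SameOrder w (restrict> j α)) (sym std-B) (SameOrder-sym (SameOrder-std (restrict> j α))))

    length-merged : length merged ≡ length α
    length-merged = length-mergeBy _ α A B

    merged-↭ : merged ↭ A ++ B
    merged-↭ = mergeBy-↭ (_≤? j) α A B length-A length-B

    restrict-merged : restrict≤ m merged ≡ A × restrict> m merged ≡ B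
    restrict-merged = filter-mergeBy (_≤? j) (_≤? m) α A B length-A length-B (λ _ → All.lookup A-low)
      (λ _ y∈B y≤m → <-irrefl refl (<-≤-trans (All.lookup B-high y∈B) y≤m))

    std-merged : IsPerm α → std merged ≡ α
    std-merged π = trans (std-resp-SameOrder (mergeBy-Pointwise (_≤? j) α
      (Pointwise-mono-∈ lift-A SameOrder-A) (Pointwise-mono-∈ lift-B SameOrder-B))) (std-perm α π)

module Enumeration where

  open Intervals
  open import Data.Nat using (zero; suc; z≤n; s≤s)
  open import Data.Nat.Properties using (≤-refl; <-irrefl)
  open import Data.List using ([]; _∷_; length; _++_)
  open import Data.List.Relation.Unary.Any using (here; there)
  open import Data.List.Membership.Propositional using (_∈_; _∉_; find; lose)
  open import Data.List.Membership.Propositional.Properties using (∈-map⁺; ∈-map⁻; ∈-concatMap⁺; ∈-concatMap⁻; ∈-∃++)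
  open import Data.List.Relation.Binary.Permutation.Propositional using (_↭_; ↭-sym; ↭-trans; ↭-refl; ↭-reflexive; ↭-prep; ↭-swap)
  open import Data.List.Relation.Binary.Permutation.Propositional.Properties using (∈-resp-↭; shift; ∷↭∷ʳ; drop-∷; ↭-empty-inv)
  open import Data.Product using (_×_; _,_; proj₂; ∃₂)
  open import Relation.Binary.PropositionalEquality using (_≡_; refl; sym)
  open import Relation.Nullary using (Dec; yes; no)
  open import Data.List.Properties using (≡-dec)
  open import Data.List.Membership.DecPropositional (≡-dec Data.Nat._≟_) using (_∈?_)
  open import Function using (_∘_)

  insertions-↭ : ∀ a w {γ} → γ ∈ insertions a w → γ ↭ a ∷ w
  insertions-↭ a []      (here refl) = ↭-refl
  insertions-↭ a (b ∷ w) (here refl) = ↭-refl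
  insertions-↭ a (b ∷ w) (there γ∈) with ∈-map⁻ (b ∷_) γ∈
  ... | _ , γ'∈ , refl = ↭-trans (↭-prep b (insertions-↭ a w γ'∈)) (↭-swap b a ↭-refl)

  ∈-insertions : ∀ a W₁ W₂ → W₁ ++ a ∷ W₂ ∈ insertions a (W₁ ++ W₂)
  ∈-insertions a []       []       = here refl
  ∈-insertions a []       (b ∷ W₂) = here refl
  ∈-insertions a (c ∷ W₁) W₂       = there (∈-map⁺ (c ∷_) (∈-insertions a W₁ W₂))

  suc∷one-to-↭ : ∀ n → suc n ∷ one-to n ↭ one-to (suc n)
  suc∷one-to-↭ n = ↭-trans (∷↭∷ʳ (suc n) (one-to n)) (↭-reflexive (sym (one-to-suc n)))

  suc∉one-to : ∀ n → suc n ∉ one-to n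
  suc∉one-to n i = <-irrefl refl (proj₂ (∈-one-to⁻ n i))

  ↭-one-to-suc-split : ∀ {n} W → W ↭ one-to (suc n) → ∃₂ λ W₁ W₂ → W ≡ W₁ ++ suc n ∷ W₂ × W₁ ++ W₂ ↭ one-to n
  ↭-one-to-suc-split {n} W π with ∈-∃++ (∈-resp-↭ (↭-sym π) (∈-one-to⁺ (suc n) (s≤s z≤n) ≤-refl))
  ... | W₁ , W₂ , refl = W₁ , W₂ , refl ,
    drop-∷ (↭-trans (↭-sym (shift (suc n) W₁ W₂)) (↭-trans π (↭-sym (suc∷one-to-↭ n))))

  allPerms-↭ : ∀ n {γ} → γ ∈ allPerms n → γ ↭ one-to n
  allPerms-↭ zero (here refl) = ↭-refl
  allPerms-↭ (suc n) γ∈ with find (∈-concatMap⁻ (insertions (suc n)) {xs = allPerms n} γ∈)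
  ... | w , w∈ , γ∈ins = ↭-trans (insertions-↭ (suc n) w γ∈ins) (↭-trans (↭-prep (suc n) (allPerms-↭ n w∈)) (suc∷one-to-↭ n))

  allPerms-IsPerm : ∀ {n γ} → γ ∈ allPerms n → IsPerm γ
  allPerms-IsPerm {n} {γ} γ∈ with length-↭-one-to (allPerms-↭ n γ∈)
  ... | refl = allPerms-↭ n γ∈

  allPerms-complete : ∀ n W → W ↭ one-to n → W ∈ allPerms n
  allPerms-complete zero W π with ↭-empty-inv π
  ... | refl = here refl
  allPerms-complete (suc n) W π with ↭-one-to-suc-split W π
  ... | W₁ , W₂ , refl , π' = ∈-concatMap⁺ (insertions (suc n)) {xs = allPerms n}
          (lose (allPerms-complete n (W₁ ++ W₂) π') (∈-insertions (suc n) W₁ W₂))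

  isPerm? : ∀ w → Dec (IsPerm w)
  isPerm? w with w ∈? allPerms (length w)
  ... | yes w∈ = yes (allPerms-↭ (length w) w∈)
  ... | no w∉  = no (w∉ ∘ allPerms-complete (length w) w)

module Unshuffle (α β σ τ : Word) (πα : IsPerm α) (πβ : IsPerm β) (πσ : IsPerm σ) (πτ : IsPerm τ) where

  open Lists
  open Intervals
  open Merge
  open Enumeration
  open import Data.Nat using (ℕ; _+_; _∸_; _≤_; _≤?_; _<_)
  open import Data.Nat.Properties using (<-≤-trans; <-irrefl; m<m+n; m≤n⇒m⊓n≡m)
  open import Data.List using (map; length; take; drop; _++_)
  open import Data.List.Properties
    using (filter-++; length-filter; length-take; length-drop; length-map; length-++; take-map; drop-map; map-++; take++drop≡id; ++-assoc)
  import Data.List.Relation.Unary.All as All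
  open All using (All)
  import Data.List.Relation.Unary.All.Properties as All
  open import Data.List.Membership.Propositional using (_∈_; _∉_)
  open import Data.List.Relation.Binary.Permutation.Propositional using (_↭_; module PermutationReasoning)
  open import Data.List.Relation.Binary.Permutation.Propositional.Properties using (∈-resp-↭; ++⁺; ++⁺ˡ; shifts; map⁺)
  open import Data.Product using (_×_; _,_; proj₁; proj₂)
  open import Function using (_∘_)
  open import Function.Bundles using (_⇔_; mk⇔; Equivalence)
  open import Function.Properties.Equivalence using () renaming (trans to ⇔-trans)
  open import Data.Product.Function.NonDependent.Propositional using (_×-⇔_)
  open import Relation.Nullary using (does)
  open import Relation.Binary.PropositionalEquality

  k l m p n : ℕ
  k = length α
  l = length β
  m = length σ
  p = length τ
  n = k + l

  σ-low : All (_≤ m) σ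
  σ-low = All.tabulate (proj₂ ∘ ∈-one-to⁻ m ∘ ∈-resp-↭ πσ)

  τ-positive : All (1 ≤_) τ
  τ-positive = All.tabulate (proj₁ ∘ ∈-one-to⁻ p ∘ ∈-resp-↭ πτ)

  -- how many letters of σ, resp. of τ shifted by m, lie in the first k letters of γ
  lowCount highCount : Word → ℕ
  lowCount γ = length (restrict≤ m (take k γ))
  highCount γ = length (restrict> m (take k γ))

  prefix suffix candidate : ℕ → ℕ → Word
  prefix j j' = mergeBy (λ a → does (a ≤? j)) α (take j σ) (map (m +_) (take j' τ))
  suffix j j' = mergeBy (λ a → does (a ≤? m ∸ j)) β (drop j σ) (map (m +_) (drop j' τ))
  candidate j j' = prefix j j' ++ suffix j j'

  -- γ is a term of G_α G_β whose coproduct contains G_σ ⊗ G_τ, with split counts j, j'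
  Contributes : Word → ℕ → ℕ → Set
  Contributes γ j j' = InStar α β γ × restrict≤ m γ ≡ σ × std (restrict> m γ) ≡ τ × lowCount γ ≡ j × highCount γ ≡ j'

  Compatible : ℕ → ℕ → Set
  Compatible j j' = (restrict≤ j α ≡ std (take j σ) × std (restrict> j α) ≡ std (take j' τ)) ×
                    (restrict≤ (m ∸ j) β ≡ std (drop j σ) × std (restrict> (m ∸ j) β) ≡ std (drop j' τ))

  contributes⇒candidate : ∀ {γ j j'} → γ ↭ one-to n → Contributes γ j j' → γ ≡ candidate j j' × Compatible j j'
  contributes⇒candidate {γ} πγ ((std-u , std-v) , low-γ , high-γ , refl , refl) =
      trans (sym (take++drop≡id k γ)) (cong₂ _++_ (proj₂ (proj₂ block-u)) (proj₂ (proj₂ block-v)))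
    , (proj₁ block-u , trans (proj₁ (proj₂ block-u)) (std-shift m _))
    , (proj₁ block-v , trans (proj₁ (proj₂ block-v)) (std-shift m _))
    where
    u v : Word
    u = take k γ
    v = drop k γ

    j j' : ℕ
    j = lowCount γ
    j' = highCount γ

    m≤n : m ≤ n
    m≤n = subst₂ _≤_ (cong length low-γ) (length-↭-one-to πγ) (length-filter _ γ)

    σ-split : restrict≤ m u ++ restrict≤ m v ≡ σ
    σ-split = trans (sym (filter-++ _ u v)) (trans (cong (restrict≤ m) (take++drop≡id k γ)) low-γ)

    τ-split : restrict> m u ++ restrict> m v ≡ map (m +_) τ
    τ-split = begin
        restrict> m u ++ restrict> m v
      ≡⟨ sym (filter-++ _ u v) ⟩
        restrict> m (u ++ v)
      ≡⟨ cong (restrict> m) (take++drop≡id k γ) ⟩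
        restrict> m γ
      ≡⟨ sym (map-shift-std-shifted m (n ∸ m) _ (restrict>-↭ πγ m≤n)) ⟩
        map (m +_) (std (restrict> m γ))
      ≡⟨ cong (map (m +_)) high-γ ⟩
        map (m +_) τ ∎
      where open ≡-Reasoning

    take-σ : take j σ ≡ restrict≤ m u
    take-σ = trans (cong (take j) (sym σ-split)) (take-++-length (restrict≤ m u) _)

    drop-σ : drop j σ ≡ restrict≤ m v
    drop-σ = trans (cong (drop j) (sym σ-split)) (drop-++-length (restrict≤ m u) _)

    take-τ : map (m +_) (take j' τ) ≡ restrict> m u
    take-τ = trans (sym (take-map j' τ)) (trans (cong (take j') (sym τ-split)) (take-++-length (restrict> m u) _))

    drop-τ : map (m +_) (drop j' τ) ≡ restrict> m v
    drop-τ = trans (sym (drop-map j' τ)) (trans (cong (drop j') (sym τ-split)) (drop-++-length (restrict> m u) _))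

    block-u : restrict≤ j α ≡ std (take j σ) × std (restrict> j α) ≡ std (map (m +_) (take j' τ)) × u ≡ prefix j j'
    block-u = split-block u std-u πα (sym take-σ) (sym take-τ) (cong length take-σ)

    block-v : restrict≤ (m ∸ j) β ≡ std (drop j σ) × std (restrict> (m ∸ j) β) ≡ std (map (m +_) (drop j' τ)) × v ≡ suffix j j'
    block-v = split-block v std-v πβ (sym drop-σ) (sym drop-τ) (length-drop j σ)

  module Candidate {j j'} (j≤m : j ≤ m) (j'≤p : j' ≤ p) (compatible : Compatible j j') where

    private
      shifted-high : ∀ {w} → All (1 ≤_) w → All (m <_) (map (m +_) w)
      shifted-high pos = All.tabulate (shifted-above m (All.lookup pos))

      module P = MergeBlock m j α (take j σ) (map (m +_) (take j' τ))
        (sym (proj₁ (proj₁ compatible))) (trans (std-shift m _) (sym (proj₂ (proj₁ compatible))))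
        (All.take⁺ j σ-low) (shifted-high (All.take⁺ j' τ-positive))

      module S = MergeBlock m (m ∸ j) β (drop j σ) (map (m +_) (drop j' τ))
        (sym (proj₁ (proj₂ compatible))) (trans (std-shift m _) (sym (proj₂ (proj₂ compatible))))
        (All.drop⁺ j σ-low) (shifted-high (All.drop⁺ j' τ-positive))

      1∉shifted : 1 ≤ m → ∀ {w} → All (1 ≤_) w → 1 ∉ map (m +_) w
      1∉shifted 1≤m pos 1∈ = <-irrefl refl (<-≤-trans (All.lookup (shifted-high pos) 1∈) 1≤m)

      top∉low : 1 ≤ p → ∀ {w} → All (_≤ m) w → m + p ∉ w
      top∉low 1≤p low top∈ = <-irrefl refl (<-≤-trans (m<m+n m 1≤p) (All.lookup low top∈))

      length-take-σ : length (take j σ) ≡ j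
      length-take-σ = trans (length-take j σ) (m≤n⇒m⊓n≡m j≤m)

    take-candidate : take k (candidate j j') ≡ prefix j j'
    take-candidate = trans (cong (λ i → take i (candidate j j')) (sym P.length-merged)) (take-++-length (prefix j j') _)

    drop-candidate : drop k (candidate j j') ≡ suffix j j'
    drop-candidate = trans (cong (λ i → drop i (candidate j j')) (sym P.length-merged)) (drop-++-length (prefix j j') _)

    private
      candidate-↭-one-to-m+p : candidate j j' ↭ one-to (m + p)
      candidate-↭-one-to-m+p = begin
          prefix j j' ++ suffix j j'
        ↭⟨ ++⁺ P.merged-↭ S.merged-↭ ⟩
          (take j σ ++ map (m +_) (take j' τ)) ++ (drop j σ ++ map (m +_) (drop j' τ))
        ≡⟨ ++-assoc (take j σ) _ _ ⟩
          take j σ ++ (map (m +_) (take j' τ) ++ drop j σ ++ map (m +_) (drop j' τ))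
        ↭⟨ ++⁺ˡ (take j σ) (shifts (map (m +_) (take j' τ)) (drop j σ)) ⟩
          take j σ ++ (drop j σ ++ map (m +_) (take j' τ) ++ map (m +_) (drop j' τ))
        ≡⟨ sym (++-assoc (take j σ) _ _) ⟩
          (take j σ ++ drop j σ) ++ (map (m +_) (take j' τ) ++ map (m +_) (drop j' τ))
        ≡⟨ cong₂ _++_ (take++drop≡id j σ) (trans (sym (map-++ (m +_) (take j' τ) _)) (cong (map (m +_)) (take++drop≡id j' τ))) ⟩
          σ ++ map (m +_) τ
        ↭⟨ ++⁺ πσ (map⁺ (m +_) πτ) ⟩
          one-to m ++ map (m +_) (one-to p)
        ≡⟨ one-to-++ m p ⟩
          one-to (m + p) ∎
        where open PermutationReasoning

    length-candidate : length (candidate j j') ≡ m + p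
    length-candidate = length-↭-one-to candidate-↭-one-to-m+p

    candidate-↭ : candidate j j' ↭ one-to n
    candidate-↭ = subst (λ i → candidate j j' ↭ one-to i) m+p≡n candidate-↭-one-to-m+p
      where
      m+p≡n : m + p ≡ n
      m+p≡n = trans (sym length-candidate) (trans (length-++ (prefix j j')) (cong₂ _+_ P.length-merged S.length-merged))

    candidate-contributes : Contributes (candidate j j') j j'
    candidate-contributes =
        (trans (cong std take-candidate) (P.std-merged πα) , trans (cong std drop-candidate) (S.std-merged πβ))
      , trans (filter-++ _ (prefix j j') (suffix j j'))
          (trans (cong₂ _++_ (proj₁ P.restrict-merged) (proj₁ S.restrict-merged)) (take++drop≡id j σ))
      , trans (cong std restrict>-candidate) (trans (std-shift m τ) (std-perm τ πτ))
      , trans (cong (length ∘ restrict≤ m) take-candidate) (trans (cong length (proj₁ P.restrict-merged)) length-take-σ)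
      , trans (cong (length ∘ restrict> m) take-candidate)
          (trans (cong length (proj₂ P.restrict-merged)) (trans (length-map (m +_) (take j' τ)) (trans (length-take j' τ) (m≤n⇒m⊓n≡m j'≤p))))
      where
      restrict>-candidate : restrict> m (candidate j j') ≡ map (m +_) τ
      restrict>-candidate = trans (filter-++ _ (prefix j j') (suffix j j'))
        (trans (cong₂ _++_ (proj₂ P.restrict-merged) (proj₂ S.restrict-merged))
        (trans (sym (map-++ (m +_) (take j' τ) (drop j' τ))) (cong (map (m +_)) (take++drop≡id j' τ))))

    private
      1∈prefix⇔ : 1 ≤ m → 1 ∈ prefix j j' ⇔ 1 ∈ take j σ
      1∈prefix⇔ 1≤m = ∈-↭-++ˡ P.merged-↭ (1∉shifted 1≤m (All.take⁺ j' τ-positive))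

      1∈suffix⇔ : 1 ≤ m → 1 ∈ suffix j j' ⇔ 1 ∈ drop j σ
      1∈suffix⇔ 1≤m = ∈-↭-++ˡ S.merged-↭ (1∉shifted 1≤m (All.drop⁺ j' τ-positive))

      top∈prefix⇔ : 1 ≤ p → m + p ∈ prefix j j' ⇔ p ∈ take j' τ
      top∈prefix⇔ 1≤p = ⇔-trans (∈-↭-++ʳ P.merged-↭ (top∉low 1≤p (All.take⁺ j σ-low))) (∈-map-+ m (take j' τ))

      top∈suffix⇔ : 1 ≤ p → m + p ∈ suffix j j' ⇔ p ∈ drop j' τ
      top∈suffix⇔ 1≤p = ⇔-trans (∈-↭-++ʳ S.merged-↭ (top∉low 1≤p (All.drop⁺ j σ-low))) (∈-map-+ m (drop j' τ))

    InNE-candidate : 1 ≤ m → 1 ≤ p → InNE α β (candidate j j') ⇔ (1 ∈ take j σ × p ∈ drop j' τ)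
    InNE-candidate 1≤m 1≤p = mk⇔ (Equivalence.to extremes ∘ proj₂) (λ c → proj₁ candidate-contributes , Equivalence.from extremes c)
      where
      extremes : (1 ∈ take k (candidate j j') × length (candidate j j') ∈ drop k (candidate j j')) ⇔ (1 ∈ take j σ × p ∈ drop j' τ)
      extremes rewrite take-candidate | drop-candidate | length-candidate = 1∈prefix⇔ 1≤m ×-⇔ top∈suffix⇔ 1≤p

    InSW-candidate : 1 ≤ m → 1 ≤ p → InSW α β (candidate j j') ⇔ (1 ∈ drop j σ × p ∈ take j' τ)
    InSW-candidate 1≤m 1≤p = mk⇔ (Equivalence.to extremes ∘ proj₂) (λ c → proj₁ candidate-contributes , Equivalence.from extremes c)
      where
      extremes : (1 ∈ drop k (candidate j j') × length (candidate j j') ∈ take k (candidate j j')) ⇔ (1 ∈ drop j σ × p ∈ take j' τ)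
      extremes rewrite take-candidate | drop-candidate | length-candidate = 1∈suffix⇔ 1≤m ×-⇔ top∈prefix⇔ 1≤p

module Sums {c ℓ} (R : CommutativeRing c ℓ) where

  open CommutativeRing R renaming (Carrier to K)
  open import Algebra.Properties.Ring ring using (-0#≈0#)
  open import Algebra.Properties.AbelianGroup +-abelianGroup using (⁻¹-∙-comm)
  open import Algebra.Properties.CommutativeSemigroup +-commutativeSemigroup using (interchange)
  open import Relation.Binary.Reasoning.Setoid setoid
  open import Algebra.Solver.CommutativeMonoid *-commutativeMonoid using (solve; _⊕_; _⊜_)
  open import Data.Sum using (_⊎_; inj₁; inj₂)
  open import Data.Nat using (ℕ; zero; suc; _≤_; _<_; z≤n; _≟_)
  open import Data.Nat.Properties using (m≤n⇒m≤1+n; ≤-refl; <-irrefl; ≤∧≢⇒<; <-≤-trans)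
  open import Data.List using (List; []; _∷_; map; filter; _++_; upTo; concatMap; [_])
  open import Data.List.Properties using (upTo-∷ʳ)
  open import Data.List.Relation.Unary.Any using (here; there)
  open import Data.List.Membership.Propositional using (_∈_)
  open import Data.List.Membership.Propositional.Properties using (∈-upTo⁻)
  open import Data.Product using (_×_; proj₁; proj₂)
  open import Function using (_∘_)
  open import Function.Bundles using (_⇔_; Equivalence)
  open import Relation.Nullary using (¬_; Dec; yes; no)
  open import Relation.Nullary.Decidable using (_×-dec_)
  open import Relation.Unary using (Pred; Decidable)
  import Relation.Binary.PropositionalEquality as ≡
  open import Data.Empty using (⊥-elim)

  ι : ∀ {p} {Q : Set p} → Dec Q → K
  ι (yes _) = 1#
  ι (no _)  = 0#

  ι-yes : ∀ {p} {Q : Set p} (Q? : Dec Q) → Q → ι Q? ≈ 1#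
  ι-yes (yes _) _ = refl
  ι-yes (no ¬q) q = ⊥-elim (¬q q)

  ι-no : ∀ {p} {Q : Set p} (Q? : Dec Q) → ¬ Q → ι Q? ≈ 0#
  ι-no (yes q) ¬q = ⊥-elim (¬q q)
  ι-no (no _)  _  = refl

  ι-cong : ∀ {p q} {P : Set p} {Q : Set q} (P? : Dec P) (Q? : Dec Q) → P ⇔ Q → ι P? ≈ ι Q?
  ι-cong (yes p) Q? P⇔Q = sym (ι-yes Q? (Equivalence.to P⇔Q p))
  ι-cong (no ¬p) Q? P⇔Q = sym (ι-no Q? (¬p ∘ Equivalence.from P⇔Q))

  ι-× : ∀ {p q} {P : Set p} {Q : Set q} (P? : Dec P) (Q? : Dec Q) → ι (P? ×-dec Q?) ≈ ι P? * ι Q?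
  ι-× (yes _) (yes _) = sym (*-identityˡ 1#)
  ι-× (yes _) (no _)  = sym (zeroʳ 1#)
  ι-× (no _)  Q?      = sym (zeroˡ (ι Q?))

  *≈0ˡ : ∀ {a b} → a ≈ 0# → a * b ≈ 0#
  *≈0ˡ a≈0 = trans (*-cong a≈0 refl) (zeroˡ _)

  *≈0ʳ : ∀ {a b} → b ≈ 0# → a * b ≈ 0#
  *≈0ʳ b≈0 = trans (*-cong refl b≈0) (zeroʳ _)

  module _ {a} {A : Set a} where

    ∑ : List A → (A → K) → K
    ∑ []      f = 0#
    ∑ (x ∷ L) f = f x + ∑ L f

    ∑-cong-∈ : ∀ L {f g : A → K} → (∀ {x} → x ∈ L → f x ≈ g x) → ∑ L f ≈ ∑ L g
    ∑-cong-∈ []      f≈g = refl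
    ∑-cong-∈ (x ∷ L) f≈g = +-cong (f≈g (here ≡.refl)) (∑-cong-∈ L (f≈g ∘ there))

    ∑-cong : ∀ L {f g : A → K} → (∀ x → f x ≈ g x) → ∑ L f ≈ ∑ L g
    ∑-cong L f≈g = ∑-cong-∈ L (λ {x} _ → f≈g x)

    ∑-zero : ∀ L {f : A → K} → (∀ {x} → x ∈ L → f x ≈ 0#) → ∑ L f ≈ 0#
    ∑-zero []      f≈0 = refl
    ∑-zero (x ∷ L) f≈0 = trans (+-cong (f≈0 (here ≡.refl)) (∑-zero L (f≈0 ∘ there))) (+-identityˡ 0#)

    ∑-++ : ∀ L M (f : A → K) → ∑ (L ++ M) f ≈ ∑ L f + ∑ M f
    ∑-++ []      M f = sym (+-identityˡ _)
    ∑-++ (x ∷ L) M f = trans (+-cong refl (∑-++ L M f)) (sym (+-assoc _ _ _))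

    ∑-+ : ∀ L (f g : A → K) → ∑ L (λ x → f x + g x) ≈ ∑ L f + ∑ L g
    ∑-+ []      f g = sym (+-identityˡ 0#)
    ∑-+ (x ∷ L) f g = trans (+-cong refl (∑-+ L f g)) (interchange _ _ _ _)

    ∑-*ˡ : ∀ L (k : K) (f : A → K) → k * ∑ L f ≈ ∑ L (λ x → k * f x)
    ∑-*ˡ []      k f = zeroʳ k
    ∑-*ˡ (x ∷ L) k f = trans (distribˡ k _ _) (+-cong refl (∑-*ˡ L k f))

    ∑-*ʳ : ∀ L (k : K) (f : A → K) → ∑ L f * k ≈ ∑ L (λ x → f x * k)
    ∑-*ʳ L k f = trans (*-comm _ _) (trans (∑-*ˡ L k f) (∑-cong L (λ x → *-comm _ _)))

    ∑-neg : ∀ L (f : A → K) → - ∑ L f ≈ ∑ L (λ x → - f x)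
    ∑-neg []      f = -0#≈0#
    ∑-neg (x ∷ L) f = trans (sym (⁻¹-∙-comm _ _)) (+-cong refl (∑-neg L f))

    ∑-filter : ∀ {p} {Q : Pred A p} (Q? : Decidable Q) L (f : A → K) → ∑ (filter Q? L) f ≈ ∑ L (λ x → ι (Q? x) * f x)
    ∑-filter Q? []      f = refl
    ∑-filter Q? (x ∷ L) f with Q? x
    ... | yes _ = +-cong (sym (*-identityˡ _)) (∑-filter Q? L f)
    ... | no _  = trans (sym (+-identityˡ _)) (+-cong (sym (zeroˡ _)) (∑-filter Q? L f))

  module _ {a b} {A : Set a} {B : Set b} where

    ∑-map : ∀ (h : A → B) L (f : B → K) → ∑ (map h L) f ≈ ∑ L (f ∘ h)
    ∑-map h []      f = refl
    ∑-map h (x ∷ L) f = +-cong refl (∑-map h L f)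

    ∑-concatMap : ∀ (h : A → List B) L (f : B → K) → ∑ (concatMap h L) f ≈ ∑ L (λ x → ∑ (h x) f)
    ∑-concatMap h []      f = refl
    ∑-concatMap h (x ∷ L) f = trans (∑-++ (h x) (concatMap h L) f) (+-cong refl (∑-concatMap h L f))

    ∑-comm : ∀ (L : List A) (M : List B) (f : A → B → K) → ∑ L (λ x → ∑ M (f x)) ≈ ∑ M (λ y → ∑ L (λ x → f x y))
    ∑-comm []      M f = sym (∑-zero M (λ _ → refl))
    ∑-comm (x ∷ L) M f = trans (+-cong refl (∑-comm L M f)) (sym (∑-+ M (f x) (λ y → ∑ L (λ x → f x y))))

  ∑-upTo-suc : ∀ N (g : ℕ → K) → ∑ (upTo (suc N)) g ≈ ∑ (upTo N) g + g N
  ∑-upTo-suc N g = begin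
      ∑ (upTo (suc N)) g
    ≡⟨ ≡.cong (λ L → ∑ L g) (≡.sym (upTo-∷ʳ N)) ⟩
      ∑ (upTo N ++ [ N ]) g
    ≈⟨ ∑-++ (upTo N) [ N ] g ⟩
      ∑ (upTo N) g + (g N + 0#)
    ≈⟨ +-cong refl (+-identityʳ _) ⟩
      ∑ (upTo N) g + g N ∎

  ∑-upTo-single : ∀ N (g : ℕ → K) i₀ → (∀ i → i < N → i ≡.≢ i₀ → g i ≈ 0#) → (N ≤ i₀ → g i₀ ≈ 0#) → ∑ (upTo N) g ≈ g i₀
  ∑-upTo-single zero    g i₀ off out = sym (out z≤n)
  ∑-upTo-single (suc N) g i₀ off out with i₀ ≟ N
  ... | yes ≡.refl = begin
      ∑ (upTo (suc N)) g
    ≈⟨ ∑-upTo-suc N g ⟩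
      ∑ (upTo N) g + g N
    ≈⟨ +-cong (∑-zero (upTo N) (λ i∈ → off _ (m≤n⇒m≤1+n (∈-upTo⁻ i∈)) (λ i≡N → <-irrefl i≡N (∈-upTo⁻ i∈)))) refl ⟩
      0# + g N
    ≈⟨ +-identityˡ _ ⟩
      g N ∎
  ... | no i₀≢N = begin
      ∑ (upTo (suc N)) g
    ≈⟨ ∑-upTo-suc N g ⟩
      ∑ (upTo N) g + g N
    ≈⟨ +-cong (∑-upTo-single N g i₀ (λ i i<N → off i (m≤n⇒m≤1+n i<N)) (λ N≤i₀ → out (≤∧≢⇒< N≤i₀ (i₀≢N ∘ ≡.sym))))
              (off N ≤-refl (i₀≢N ∘ ≡.sym)) ⟩
      g i₀ + 0#
    ≈⟨ +-identityʳ _ ⟩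
      g i₀ ∎

  ∑-upTo-ι≡ : ∀ N i₀ (X : K) → (N ≤ i₀ → X ≈ 0#) → ∑ (upTo N) (λ i → ι (i₀ ≟ i) * X) ≈ X
  ∑-upTo-ι≡ N i₀ X out = trans
    (∑-upTo-single N _ i₀ (λ i _ i≢i₀ → *≈0ˡ (ι-no (i₀ ≟ i) (i≢i₀ ∘ ≡.sym)))
                          (λ N≤i₀ → *≈0ʳ (out N≤i₀)))
    (trans (*-cong (ι-yes (i₀ ≟ i₀) ≡.refl) refl) (*-identityˡ X))

  ∑-upTo²-single : ∀ M P (g : ℕ → ℕ → K) j₀ j₀' → j₀ < M → j₀' < P →
    (∀ j j' → j < M → j' < P → j ≡.≢ j₀ ⊎ j' ≡.≢ j₀' → g j j' ≈ 0#) →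
    ∑ (upTo M) (λ j → ∑ (upTo P) (g j)) ≈ g j₀ j₀'
  ∑-upTo²-single M P g j₀ j₀' j₀<M j₀'<P vanish = trans
    (∑-upTo-single M _ j₀ (λ j j<M j≢j₀ → ∑-zero (upTo P) (λ j'∈ → vanish j _ j<M (∈-upTo⁻ j'∈) (inj₁ j≢j₀)))
                          (λ M≤j₀ → ⊥-elim (<-irrefl ≡.refl (<-≤-trans j₀<M M≤j₀))))
    (∑-upTo-single P (g j₀) j₀' (λ j' j'<P j'≢j₀' → vanish j₀ j' j₀<M j'<P (inj₂ j'≢j₀'))
                                (λ P≤j₀' → ⊥-elim (<-irrefl ≡.refl (<-≤-trans j₀'<P P≤j₀'))))

  ∑²-bilinear : ∀ {a b} {X : Set a} {Y : Set b} (x : List (K × X)) (y : List (K × Y)) (I J : List ℕ)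
    (c : ℕ → ℕ → K) (f : X → ℕ → ℕ → K) (g : Y → ℕ → ℕ → K) →
    ∑ x (λ s → ∑ y (λ t → (proj₁ s * proj₁ t) * ∑ I (λ i → ∑ J (λ j → c i j * (f (proj₂ s) i j * g (proj₂ t) i j))))) ≈
    ∑ I (λ i → ∑ J (λ j → c i j * (∑ x (λ s → proj₁ s * f (proj₂ s) i j) * ∑ y (λ t → proj₁ t * g (proj₂ t) i j))))
  ∑²-bilinear {X = X} {Y = Y} x y I J c f g = begin
      ∑ x (λ s → ∑ y (λ t → (proj₁ s * proj₁ t) * ∑ I (λ i → ∑ J (λ j → c i j * (f (proj₂ s) i j * g (proj₂ t) i j)))))
    ≈⟨ ∑-cong x (λ s → ∑-cong y (λ t → trans (∑-*ˡ I _ _) (∑-cong I (λ i → trans (∑-*ˡ J _ _) (∑-cong J (λ j → regroup _ _ _ _ _)))))) ⟩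
      ∑ x (λ s → ∑ y (λ t → ∑ I (λ i → ∑ J (λ j → term s t i j))))
    ≈⟨ ∑-cong x (λ s → ∑-comm y I _) ⟩
      ∑ x (λ s → ∑ I (λ i → ∑ y (λ t → ∑ J (λ j → term s t i j))))
    ≈⟨ ∑-comm x I _ ⟩
      ∑ I (λ i → ∑ x (λ s → ∑ y (λ t → ∑ J (λ j → term s t i j))))
    ≈⟨ ∑-cong I (λ i → ∑-cong x (λ s → ∑-comm y J _)) ⟩
      ∑ I (λ i → ∑ x (λ s → ∑ J (λ j → ∑ y (λ t → term s t i j))))
    ≈⟨ ∑-cong I (λ i → ∑-comm x J _) ⟩
      ∑ I (λ i → ∑ J (λ j → ∑ x (λ s → ∑ y (λ t → term s t i j))))
    ≈⟨ ∑-cong I (λ i → ∑-cong J (λ j → trans (∑-cong x (λ s → sym (∑-*ˡ y _ _))) (trans (sym (∑-*ˡ x _ _))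
         (*-cong refl (trans (∑-cong x (λ s → sym (∑-*ˡ y _ _))) (sym (∑-*ʳ x _ _))))))) ⟩
      ∑ I (λ i → ∑ J (λ j → c i j * (∑ x (λ s → proj₁ s * f (proj₂ s) i j) * ∑ y (λ t → proj₁ t * g (proj₂ t) i j)))) ∎
    where
    term : K × X → K × Y → ℕ → ℕ → K
    term s t i j = c i j * ((proj₁ s * f (proj₂ s) i j) * (proj₁ t * g (proj₂ t) i j))
    regroup : ∀ a b c′ u v → (a * b) * (c′ * (u * v)) ≈ c′ * ((a * u) * (b * v))
    regroup = solve 5 (λ a b c′ u v → (a ⊕ b) ⊕ (c′ ⊕ (u ⊕ v)) ⊜ c′ ⊕ ((a ⊕ u) ⊕ (b ⊕ v))) refl

module Coefficients {c ℓ} (R : CommutativeRing c ℓ) where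

  open Intervals
  open Enumeration
  open Sums R
  open FQ R
  open CommutativeRing R renaming (Carrier to K)
  open import Algebra.Properties.Ring ring using (-‿distribˡ-*)
  open import Relation.Binary.Reasoning.Setoid setoid
  open import Data.Nat using (ℕ; zero; suc; _≤_; _<_; _∸_; _≟_; _≤?_)
  open import Data.Nat.Properties using (≤-pred; ≤-trans; <-irrefl; m<n⇒0<n∸m; <⇒≱; <⇒≤; ≤∧≢⇒<)
  open import Data.List using ([]; _∷_; map; length; _++_; upTo; concatMap)
  open import Data.List.Properties using (≡-dec; length-filter; length-map; ∷-injectiveʳ; filter-all; filter-none)
  import Data.List.Relation.Unary.All as All
  open All using (All)
  import Data.List.Relation.Unary.All.Properties as All
  open import Data.Empty using (⊥-elim)
  open import Data.List.Relation.Unary.Any using (here; there)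
  open import Data.List.Membership.Propositional using (_∈_; _∉_)
  open import Data.List.Membership.Propositional.Properties using (∈-++⁺ˡ)
  open import Data.List.Relation.Binary.Permutation.Propositional using (_↭_)
  open import Data.List.Relation.Binary.Permutation.Propositional.Properties using (∈-resp-↭; ↭-empty-inv)
  open import Data.Product using (_×_; _,_; proj₁; proj₂)
  open import Function using (_∘_)
  open import Function.Bundles using (mk⇔)
  open import Relation.Nullary using (¬_; Dec; yes; no; does)
  open import Relation.Nullary.Decidable using (_×-dec_)
  open import Data.Bool using (if_then_else_)
  open import Relation.Binary.Definitions using (DecidableEquality)
  import Relation.Binary.PropositionalEquality as ≡

  _≟w_ : DecidableEquality Word
  _≟w_ = ≡-dec _≟_

  opaque
    δ : Word → Word → K
    δ w w' = ι (w ≟w w')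

    δ-refl : ∀ w → δ w w ≈ 1#
    δ-refl w = ι-yes (w ≟w w) ≡.refl

    δ-≢ : ∀ {w w'} → w ≡.≢ w' → δ w w' ≈ 0#
    δ-≢ {w} {w'} = ι-no (w ≟w w')

    δ-length : ∀ {w w'} → length w ≡.≢ length w' → δ w w' ≈ 0#
    δ-length {w} {w'} ne = δ-≢ {w} {w'} (ne ∘ ≡.cong length)

    δ-∷ : ∀ b u v → δ (b ∷ u) (b ∷ v) ≈ δ u v
    δ-∷ b u v = ι-cong ((b ∷ u) ≟w (b ∷ v)) (u ≟w v) (mk⇔ ∷-injectiveʳ (≡.cong (b ∷_)))

    δ-∷-≢ : ∀ {b c} u v → b ≡.≢ c → δ (b ∷ u) (c ∷ v) ≈ 0#
    δ-∷-≢ {b} {c} u v b≢c = δ-≢ {b ∷ u} {c ∷ v} (λ { ≡.refl → b≢c ≡.refl })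

    δ≈ι : ∀ w w' → δ w w' ≈ ι (w ≟w w')
    δ≈ι w w' = refl

  ∑-insertions-δ : ∀ a w W₁ W₂ → a ∉ w → a ∉ W₁ → ∑ (insertions a w) (λ γ → δ γ (W₁ ++ a ∷ W₂)) ≈ δ w (W₁ ++ W₂)
  ∑-insertions-δ a [] [] [] _ _ = trans (+-identityʳ _) (trans (δ-refl _) (sym (δ-refl [])))
  ∑-insertions-δ a [] [] (b ∷ W₂) _ _ = trans (+-identityʳ _) (trans (δ-length λ ()) (sym (δ-length λ ())))
  ∑-insertions-δ a [] (c ∷ W₁) W₂ _ a∉W₁ = trans (+-identityʳ _) (trans (δ-∷-≢ [] _ (a∉W₁ ∘ here)) (sym (δ-length λ ())))
  ∑-insertions-δ a (b ∷ w) [] W₂ a∉w _ = begin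
      δ (a ∷ b ∷ w) (a ∷ W₂) + ∑ (map (b ∷_) (insertions a w)) (λ γ → δ γ (a ∷ W₂))
    ≈⟨ +-cong (δ-∷ a _ _) (trans (∑-map _ (insertions a w) _) (∑-zero (insertions a w) (λ {γ} _ → δ-∷-≢ γ W₂ (a∉w ∘ here ∘ ≡.sym)))) ⟩
      δ (b ∷ w) W₂ + 0#
    ≈⟨ +-identityʳ _ ⟩
      δ (b ∷ w) W₂ ∎
  ∑-insertions-δ a (b ∷ w) (c ∷ W₁) W₂ a∉w a∉W₁ = begin
      δ (a ∷ b ∷ w) (c ∷ W₁ ++ a ∷ W₂) + ∑ (map (b ∷_) (insertions a w)) (λ γ → δ γ (c ∷ W₁ ++ a ∷ W₂))
    ≈⟨ +-cong (δ-∷-≢ _ _ (a∉W₁ ∘ here)) (∑-map _ (insertions a w) _) ⟩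
      0# + ∑ (insertions a w) (λ γ → δ (b ∷ γ) (c ∷ W₁ ++ a ∷ W₂))
    ≈⟨ +-identityˡ _ ⟩
      ∑ (insertions a w) (λ γ → δ (b ∷ γ) (c ∷ W₁ ++ a ∷ W₂))
    ≈⟨ tail (b ≟ c) ⟩
      δ (b ∷ w) (c ∷ W₁ ++ W₂) ∎
    where
    tail : Dec (b ≡.≡ c) → ∑ (insertions a w) (λ γ → δ (b ∷ γ) (c ∷ W₁ ++ a ∷ W₂)) ≈ δ (b ∷ w) (c ∷ W₁ ++ W₂)
    tail (yes ≡.refl) = trans (∑-cong (insertions a w) (λ γ → δ-∷ b γ _))
      (trans (∑-insertions-δ a w W₁ W₂ (a∉w ∘ there) (a∉W₁ ∘ there)) (sym (δ-∷ b w _)))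
    tail (no b≢c) = trans (∑-zero (insertions a w) (λ {γ} _ → δ-∷-≢ γ _ b≢c)) (sym (δ-∷-≢ w _ b≢c))

  ∑-allPerms-δ : ∀ n W → W ↭ one-to n → ∑ (allPerms n) (λ γ → δ γ W) ≈ 1#
  ∑-allPerms-δ zero W π with ↭-empty-inv π
  ... | ≡.refl = trans (+-identityʳ _) (δ-refl [])
  ∑-allPerms-δ (suc n) W π with ↭-one-to-suc-split W π
  ... | W₁ , W₂ , ≡.refl , π' = begin
      ∑ (concatMap (insertions (suc n)) (allPerms n)) (λ γ → δ γ (W₁ ++ suc n ∷ W₂))
    ≈⟨ ∑-concatMap (insertions (suc n)) (allPerms n) _ ⟩
      ∑ (allPerms n) (λ w → ∑ (insertions (suc n) w) (λ γ → δ γ (W₁ ++ suc n ∷ W₂)))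
    ≈⟨ ∑-cong-∈ (allPerms n) (λ {w} w∈ → ∑-insertions-δ (suc n) w W₁ W₂
         (suc∉one-to n ∘ ∈-resp-↭ (allPerms-↭ n w∈)) (suc∉one-to n ∘ ∈-resp-↭ π' ∘ ∈-++⁺ˡ)) ⟩
      ∑ (allPerms n) (λ w → δ w (W₁ ++ W₂))
    ≈⟨ ∑-allPerms-δ n (W₁ ++ W₂) π' ⟩
      1# ∎

  linExt : FQSym → (Word → K) → K
  linExt x φ = ∑ x (λ s → proj₁ s * φ (proj₂ s))

  linExt⊗ : FQSym⊗ → (Word → Word → K) → K
  linExt⊗ t φ = ∑ t (λ s → proj₁ s * φ (proj₁ (proj₂ s)) (proj₂ (proj₂ s)))

  coeff⊗≈linExt⊗ : ∀ t σ τ → coeff⊗ t σ τ ≈ linExt⊗ t (λ w w' → δ w σ * δ w' τ)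
  coeff⊗≈linExt⊗ [] σ τ = refl
  coeff⊗≈linExt⊗ ((a , w , w') ∷ t) σ τ = trans (if-does ((w ≟w σ) ×-dec (w' ≟w τ)))
    (+-cong (*-cong refl (trans (ι-× (w ≟w σ) (w' ≟w τ)) (sym (*-cong (δ≈ι w σ) (δ≈ι w' τ))))) (coeff⊗≈linExt⊗ t σ τ))
    where
    if-does : ∀ {p} {P : Set p} (P? : Dec P) {r} → (if does P? then a + r else r) ≈ a * ι P? + r
    if-does (yes _) = +-cong (sym (*-identityʳ a)) refl
    if-does (no _)  = sym (trans (+-cong (zeroʳ a) refl) (+-identityˡ _))

  Δcoeff primCoeff : Word → Word → Word → K
  Δcoeff γ σ τ = ∑ (coprodTerms γ) (λ (u , v) → δ u σ * δ v τ)
  primCoeff γ σ τ = δ γ σ * δ [] τ + δ [] σ * δ γ τ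

  coeff⊗-Δ : ∀ x σ τ → coeff⊗ (Δ x) σ τ ≈ linExt x (λ γ → Δcoeff γ σ τ)
  coeff⊗-Δ x σ τ = begin
      coeff⊗ (Δ x) σ τ
    ≈⟨ coeff⊗≈linExt⊗ (Δ x) σ τ ⟩
      linExt⊗ (Δ x) _
    ≈⟨ ∑-concatMap _ x _ ⟩
      ∑ x (λ s → ∑ (map (proj₁ s ,_) (coprodTerms (proj₂ s))) _)
    ≈⟨ ∑-cong x (λ s → trans (∑-map _ (coprodTerms (proj₂ s)) _) (sym (∑-*ˡ (coprodTerms (proj₂ s)) (proj₁ s) _))) ⟩
      linExt x (λ γ → Δcoeff γ σ τ) ∎

  coeff⊗-⊗1+1⊗ : ∀ x σ τ → coeff⊗ (⊗1+1⊗ x) σ τ ≈ linExt x (λ γ → primCoeff γ σ τ)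
  coeff⊗-⊗1+1⊗ x σ τ = begin
      coeff⊗ (⊗1+1⊗ x) σ τ
    ≈⟨ coeff⊗≈linExt⊗ (⊗1+1⊗ x) σ τ ⟩
      linExt⊗ (⊗1+1⊗ x) _
    ≈⟨ ∑-++ (map _ x) (map _ x) _ ⟩
      linExt⊗ (map _ x) _ + linExt⊗ (map _ x) _
    ≈⟨ +-cong (∑-map _ x _) (∑-map _ x _) ⟩
      ∑ x (λ s → proj₁ s * (δ (proj₂ s) σ * δ [] τ)) + ∑ x (λ s → proj₁ s * (δ [] σ * δ (proj₂ s) τ))
    ≈⟨ sym (∑-+ x _ _) ⟩
      ∑ x (λ s → proj₁ s * (δ (proj₂ s) σ * δ [] τ) + proj₁ s * (δ [] σ * δ (proj₂ s) τ))
    ≈⟨ ∑-cong x (λ s → sym (distribˡ _ _ _)) ⟩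
      linExt x (λ γ → primCoeff γ σ τ) ∎

  linExt-− : ∀ x y φ → linExt (x − y) φ ≈ linExt x φ - linExt y φ
  linExt-− x y φ = begin
      linExt (x − y) φ
    ≈⟨ ∑-++ x (map _ y) _ ⟩
      linExt x φ + ∑ (map (λ t → (- proj₁ t , proj₂ t)) y) (λ s → proj₁ s * φ (proj₂ s))
    ≈⟨ +-cong refl (∑-map _ y _) ⟩
      linExt x φ + ∑ y (λ t → - proj₁ t * φ (proj₂ t))
    ≈⟨ +-cong refl (trans (∑-cong y (λ t → sym (-‿distribˡ-* _ _))) (sym (∑-neg y _))) ⟩
      linExt x φ - linExt y φ ∎

  linExt-bilin : ∀ f x y φ → linExt (bilin f x y) φ ≈ ∑ x (λ s → ∑ y (λ t → (proj₁ s * proj₁ t) * ∑ (f (proj₂ s) (proj₂ t)) φ))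
  linExt-bilin f x y φ = begin
      linExt (bilin f x y) φ
    ≈⟨ ∑-concatMap _ x _ ⟩
      ∑ x (λ s → ∑ (concatMap _ y) _)
    ≈⟨ ∑-cong x (λ s → ∑-concatMap _ y _) ⟩
      ∑ x (λ s → ∑ y (λ t → ∑ (map (proj₁ s * proj₁ t ,_) (f (proj₂ s) (proj₂ t))) (λ r → proj₁ r * φ (proj₂ r))))
    ≈⟨ ∑-cong x (λ s → ∑-cong y (λ t → trans (∑-map _ (f (proj₂ s) (proj₂ t)) _) (sym (∑-*ˡ (f (proj₂ s) (proj₂ t)) _ φ)))) ⟩
      ∑ x (λ s → ∑ y (λ t → (proj₁ s * proj₁ t) * ∑ (f (proj₂ s) (proj₂ t)) φ)) ∎

  module _ {p} {P : Word → Set p} where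

    linExt-cong-All : ∀ {z} → All (P ∘ proj₂) z → {φ ψ : Word → K} → (∀ {γ} → P γ → φ γ ≈ ψ γ) → linExt z φ ≈ linExt z ψ
    linExt-cong-All {z} Pz φ≈ψ = ∑-cong-∈ z (λ t∈ → *-cong refl (φ≈ψ (All.lookup Pz t∈)))

    All-− : ∀ {x y} → All (P ∘ proj₂) x → All (P ∘ proj₂) y → All (P ∘ proj₂) (x − y)
    All-− Px Py = All.++⁺ Px (All.map⁺ Py)

    All-bilin : ∀ f {x y} → (∀ {s t} → s ∈ x → t ∈ y → All P (f (proj₂ s) (proj₂ t))) → All (P ∘ proj₂) (bilin f x y)
    All-bilin f {x} {y} P-terms = All.concat⁺ (All.map⁺ {xs = x} (All.tabulate row))
      where
      row : ∀ {s} → s ∈ x → All (P ∘ proj₂) (concatMap (λ t → map (proj₁ s * proj₁ t ,_) (f (proj₂ s) (proj₂ t))) y)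
      row {s} s∈ = All.concat⁺ (All.map⁺ {xs = y} (All.tabulate λ {t} t∈ → All.map⁺ {f = proj₁ s * proj₁ t ,_} (P-terms s∈ t∈)))

  module _ {γ : Word} (π : IsPerm γ) where

    private
      N : ℕ
      N = length γ

      bounds : All (λ a → 1 ≤ a × a ≤ N) γ
      bounds = All.tabulate (∈-one-to⁻ N ∘ ∈-resp-↭ π)

    -- only the splitting at i = |σ| can contribute
    Δcoeff-perm : ∀ σ τ → Δcoeff γ σ τ ≈ δ (restrict≤ (length σ) γ) σ * δ (std (restrict> (length σ) γ)) τ
    Δcoeff-perm σ τ = trans (∑-map _ (upTo (suc N)) _) (∑-upTo-single (suc N) _ (length σ) off out)
      where
      off : ∀ i → i < suc N → i ≡.≢ length σ → δ (restrict≤ i γ) σ * δ (std (restrict> i γ)) τ ≈ 0#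
      off i i<sN i≢m = *≈0ˡ (δ-length (i≢m ∘ ≡.trans (≡.sym (length-↭-one-to (restrict≤-↭ π (≤-pred i<sN))))))
      out : suc N ≤ length σ → δ (restrict≤ (length σ) γ) σ * δ (std (restrict> (length σ) γ)) τ ≈ 0#
      out N<m = *≈0ˡ (δ-length (λ e → <-irrefl ≡.refl (≤-trans N<m (≡.subst (_≤ N) e (length-filter _ γ)))))

    Δcoeff-perm-ι : ∀ {i} σ τ → length σ ≡.≡ i → Δcoeff γ σ τ ≈ ι (restrict≤ i γ ≟w σ) * ι (std (restrict> i γ) ≟w τ)
    Δcoeff-perm-ι σ τ ≡.refl = trans (Δcoeff-perm σ τ) (*-cong (δ≈ι _ _) (δ≈ι _ _))

    Δcoeff-[]ˡ : ∀ τ → Δcoeff γ [] τ ≈ δ γ τ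
    Δcoeff-[]ˡ τ = begin
        Δcoeff γ [] τ
      ≈⟨ Δcoeff-perm [] τ ⟩
        δ (restrict≤ 0 γ) [] * δ (std (restrict> 0 γ)) τ
      ≡⟨ ≡.cong₂ (λ u v → δ u [] * δ v τ) none (≡.trans (≡.cong std all) (std-perm γ π)) ⟩
        δ [] [] * δ γ τ
      ≈⟨ trans (*-cong (δ-refl []) refl) (*-identityˡ _) ⟩
        δ γ τ ∎
      where
      none : restrict≤ 0 γ ≡.≡ []
      none = filter-none (_≤? 0) (All.map (<⇒≱ ∘ proj₁) bounds)
      all : restrict> 0 γ ≡.≡ γ
      all = filter-all _ (All.map (<⇒≱ ∘ proj₁) bounds)

    Δcoeff-[]ʳ : ∀ σ → Δcoeff γ σ [] ≈ δ γ σ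
    Δcoeff-[]ʳ σ = begin
        Δcoeff γ σ []
      ≈⟨ ∑-map _ (upTo (suc N)) _ ⟩
        ∑ (upTo (suc N)) (λ i → δ (restrict≤ i γ) σ * δ (std (restrict> i γ)) [])
      ≈⟨ ∑-upTo-single (suc N) _ N off (λ N<N → ⊥-elim (<-irrefl ≡.refl N<N)) ⟩
        δ (restrict≤ N γ) σ * δ (std (restrict> N γ)) []
      ≡⟨ ≡.cong₂ (λ u v → δ u σ * δ (std v) []) all none ⟩
        δ γ σ * δ [] []
      ≈⟨ trans (*-cong refl (δ-refl [])) (*-identityʳ _) ⟩
        δ γ σ ∎
      where
      off : ∀ i → i < suc N → i ≡.≢ N → δ (restrict≤ i γ) σ * δ (std (restrict> i γ)) [] ≈ 0#
      off i i<sN i≢N = *≈0ʳ (δ-length (λ e → <-irrefl (≡.sym (≡.trans (≡.sym length-high) e)) (m<n⇒0<n∸m i<N)))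
        where
        i<N : i < N
        i<N = ≤∧≢⇒< (≤-pred i<sN) i≢N
        length-high : length (std (restrict> i γ)) ≡.≡ N ∸ i
        length-high = ≡.trans (length-map _ (restrict> i γ)) (length-restrict>-↭ π (<⇒≤ i<N))
      all : restrict≤ N γ ≡.≡ γ
      all = filter-all (_≤? N) (All.map proj₂ bounds)
      none : restrict> N γ ≡.≡ []
      none = filter-none _ (All.map (λ a≤N a≰N → a≰N a≤N) (All.map proj₂ bounds))

    Δcoeff-¬perm : ∀ σ τ → ¬ (IsPerm σ × IsPerm τ) → Δcoeff γ σ τ ≈ 0#
    Δcoeff-¬perm σ τ ¬perms = trans (Δcoeff-perm σ τ) (cases (restrict≤ m γ ≟w σ) (std (restrict> m γ) ≟w τ))
      where
      m : ℕ
      m = length σ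
      cases : Dec (restrict≤ m γ ≡.≡ σ) → Dec (std (restrict> m γ) ≡.≡ τ) → δ (restrict≤ m γ) σ * δ (std (restrict> m γ)) τ ≈ 0#
      cases (no low≢σ) _ = *≈0ˡ (δ-≢ low≢σ)
      cases (yes _) (no high≢τ) = *≈0ʳ (δ-≢ high≢τ)
      cases (yes low≡σ) (yes high≡τ) = ⊥-elim (¬perms (≡.subst (_↭ one-to m) low≡σ (restrict≤-↭ π m≤N) , τ-perm))
        where
        m≤N : m ≤ N
        m≤N = ≡.subst (_≤ N) (≡.cong length low≡σ) (length-filter _ γ)
        high-↭ : std (restrict> m γ) ↭ one-to (N ∸ m)
        high-↭ = std-shifted-↭ m (N ∸ m) _ (restrict>-↭ π m≤N)
        τ-perm : IsPerm τ
        τ-perm = ≡.subst (λ w → w ↭ one-to (length w)) high≡τ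
          (≡.subst (λ i → std (restrict> m γ) ↭ one-to i) (≡.sym (length-↭-one-to high-↭)) high-↭)

module Counting {c ℓ} (R : CommutativeRing c ℓ) (α β σ τ : Word)
  (πα : IsPerm α) (πβ : IsPerm β) (πσ : IsPerm σ) (πτ : IsPerm τ) where

  open Lists
  open Enumeration
  open Unshuffle α β σ τ πα πβ πσ πτ
  open Sums R
  open Coefficients R
  open CommutativeRing R renaming (Carrier to K)
  open import Relation.Binary.Reasoning.Setoid setoid
  open import Data.Nat using (ℕ; suc; _≤_; _∸_; _≟_)
  open import Data.Nat.Properties using (≤-pred; ≤-trans; <-irrefl; m≤n⇒m⊓n≡m)
  open import Data.List using (filter; length; take; drop; upTo)
  open import Data.List.Properties using (length-map; length-take; length-drop)
  open import Data.List.Membership.Propositional using (_∈_)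
  open import Data.List.Membership.Propositional.Properties using (∈-upTo⁻)
  open import Data.Product using (_×_; _,_; proj₁; proj₂)
  open import Function using (_∘_)
  open import Function.Bundles using (_⇔_; mk⇔)
  open import Function.Properties.Equivalence using () renaming (trans to ⇔-trans)
  open import Relation.Nullary using (Dec; yes; no)
  open import Relation.Nullary.Decidable using (_×-dec_)
  open import Relation.Unary using (Decidable)
  import Relation.Binary.PropositionalEquality as ≡

  private
    low-α? : ∀ j → Dec (restrict≤ j α ≡.≡ std (take j σ))
    low-α? j = restrict≤ j α ≟w std (take j σ)
    high-α? : ∀ j (j' : ℕ) → Dec (std (restrict> j α) ≡.≡ std (take j' τ))
    high-α? j j' = std (restrict> j α) ≟w std (take j' τ)
    low-β? : ∀ j → Dec (restrict≤ (m ∸ j) β ≡.≡ std (drop j σ))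
    low-β? j = restrict≤ (m ∸ j) β ≟w std (drop j σ)
    high-β? : ∀ j (j' : ℕ) → Dec (std (restrict> (m ∸ j) β) ≡.≡ std (drop j' τ))
    high-β? j j' = std (restrict> (m ∸ j) β) ≟w std (drop j' τ)

  compatible? : ∀ j j' → Dec (Compatible j j')
  compatible? j j' = (low-α? j ×-dec high-α? j j') ×-dec (low-β? j ×-dec high-β? j j')

  ι-compatible : ∀ j j' → j ≤ m →
    ι (compatible? j j') ≈ Δcoeff α (std (take j σ)) (std (take j' τ)) * Δcoeff β (std (drop j σ)) (std (drop j' τ))
  ι-compatible j j' j≤m =
    trans (trans (ι-× (low-α? j ×-dec high-α? j j') _) (*-cong (ι-× (low-α? j) _) (ι-× (low-β? j) _)))
      (sym (*-cong (Δcoeff-perm-ι πα _ _ length-std-take) (Δcoeff-perm-ι πβ _ _ length-std-drop)))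
    where
    length-std-take : length (std (take j σ)) ≡.≡ j
    length-std-take = ≡.trans (length-map _ (take j σ)) (≡.trans (length-take j σ) (m≤n⇒m⊓n≡m j≤m))
    length-std-drop : length (std (drop j σ)) ≡.≡ m ∸ j
    length-std-drop = ≡.trans (length-map _ (drop j σ)) (length-drop j σ)

  -- Q selects the terms of a restricted product such as ↗ or ↙; on candidates it becomes the condition C on the splitting.
  module _ {q r} {Q : Word → Set q} (Q? : Decidable Q) (Q⇒InStar : ∀ {γ} → Q γ → InStar α β γ)
    {C : ℕ → ℕ → Set r} (C? : ∀ j j' → Dec (C j j'))
    (Q-candidate⇔C : ∀ {j j'} → j ≤ m → j' ≤ p → Compatible j j' → Q (candidate j j') ⇔ C j j') where

    Counted : Word → ℕ → ℕ → Set q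
    Counted γ j j' = lowCount γ ≡.≡ j × highCount γ ≡.≡ j' × Q γ × restrict≤ m γ ≡.≡ σ × std (restrict> m γ) ≡.≡ τ

    private
      term? : ∀ γ → Dec (Q γ × restrict≤ m γ ≡.≡ σ × std (restrict> m γ) ≡.≡ τ)
      term? γ = Q? γ ×-dec (restrict≤ m γ ≟w σ) ×-dec (std (restrict> m γ) ≟w τ)

    counted? : ∀ γ j j' → Dec (Counted γ j j')
    counted? γ j j' = (lowCount γ ≟ j) ×-dec (highCount γ ≟ j') ×-dec term? γ

    counted⇒contributes : ∀ {γ j j'} → Counted γ j j' → Contributes γ j j'
    counted⇒contributes (low , high , qγ , restrict-low , restrict-high) = Q⇒InStar qγ , restrict-low , restrict-high , low , high

    private
      bounded : ∀ γ → Q γ × restrict≤ m γ ≡.≡ σ × std (restrict> m γ) ≡.≡ τ → lowCount γ ≤ m × highCount γ ≤ p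
      bounded γ (_ , low , high) =
          ≡.subst (lowCount γ ≤_) (≡.cong length low) (length-filter-take _ k γ)
        , ≡.subst (highCount γ ≤_) (≡.trans (≡.sym (length-map _ (restrict> m γ))) (≡.cong length high)) (length-filter-take _ k γ)

    ∑-allPerms-counted : ∀ {j j'} → j ≤ m → j' ≤ p →
      ∑ (allPerms n) (λ γ → ι (counted? γ j j')) ≈ ι (C? j j') * ι (compatible? j j')
    ∑-allPerms-counted {j} {j'} j≤m j'≤p with compatible? j j'
    ... | no ¬compatible = trans (∑-zero (allPerms n) (λ {γ} γ∈ → ι-no (counted? γ j j')
            (¬compatible ∘ proj₂ ∘ contributes⇒candidate (allPerms-↭ n γ∈) ∘ counted⇒contributes)))
          (sym (zeroʳ _))
    ... | yes compatible = begin
        ∑ (allPerms n) (λ γ → ι (counted? γ j j'))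
      ≈⟨ ∑-cong-∈ (allPerms n) only-candidate ⟩
        ∑ (allPerms n) (λ γ → δ γ (candidate j j') * ι (C? j j'))
      ≈⟨ sym (∑-*ʳ (allPerms n) _ _) ⟩
        ∑ (allPerms n) (λ γ → δ γ (candidate j j')) * ι (C? j j')
      ≈⟨ *-cong (∑-allPerms-δ n _ candidate-↭) refl ⟩
        1# * ι (C? j j')
      ≈⟨ *-comm _ _ ⟩
        ι (C? j j') * 1# ∎
      where
      open Candidate j≤m j'≤p compatible
      counted⇔C : Counted (candidate j j') j j' ⇔ C j j'
      counted⇔C = ⇔-trans (mk⇔ (proj₁ ∘ proj₂ ∘ proj₂) (λ q → let (_ , low , high , eJ , eJ') = candidate-contributes in eJ , eJ' , q , low , high))
                          (Q-candidate⇔C j≤m j'≤p compatible)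
      only-candidate : ∀ {γ} → γ ∈ allPerms n → ι (counted? γ j j') ≈ δ γ (candidate j j') * ι (C? j j')
      only-candidate {γ} γ∈ with γ ≟w candidate j j'
      ... | yes ≡.refl = trans (ι-cong (counted? γ j j') (C? j j') counted⇔C) (sym (trans (*-cong (δ-refl γ) refl) (*-identityˡ _)))
      ... | no γ≢ = trans (ι-no (counted? γ j j') (γ≢ ∘ proj₁ ∘ contributes⇒candidate (allPerms-↭ n γ∈) ∘ counted⇒contributes))
                          (sym (trans (*-cong (δ-≢ γ≢) refl) (zeroˡ _)))

    ι*Δcoeff≈∑counted : ∀ {γ} → γ ∈ allPerms n →
      ι (Q? γ) * Δcoeff γ σ τ ≈ ∑ (upTo (suc m)) (λ j → ∑ (upTo (suc p)) (λ j' → ι (counted? γ j j')))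
    ι*Δcoeff≈∑counted {γ} γ∈ = begin
        ι (Q? γ) * Δcoeff γ σ τ
      ≈⟨ *-cong refl (Δcoeff-perm-ι (allPerms-IsPerm {n} γ∈) σ τ ≡.refl) ⟩
        ι (Q? γ) * (ι low? * ι high?)
      ≈⟨ sym (trans (ι-× (Q? γ) (low? ×-dec high?)) (*-cong refl (ι-× low? high?))) ⟩
        ι (term? γ)
      ≈⟨ sym (∑-upTo-ι≡ (suc m) (lowCount γ) _ (λ m<J → ι-no (term? γ) (λ t → <-irrefl ≡.refl (≤-trans m<J (proj₁ (bounded γ t)))))) ⟩
        ∑ (upTo (suc m)) (λ j → ι (lowCount γ ≟ j) * ι (term? γ))
      ≈⟨ ∑-cong (upTo (suc m)) (λ j → *-cong refl (sym (∑-upTo-ι≡ (suc p) (highCount γ) _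
           (λ p<J' → ι-no (term? γ) (λ t → <-irrefl ≡.refl (≤-trans p<J' (proj₂ (bounded γ t)))))))) ⟩
        ∑ (upTo (suc m)) (λ j → ι (lowCount γ ≟ j) * ∑ (upTo (suc p)) (λ j' → ι (highCount γ ≟ j') * ι (term? γ)))
      ≈⟨ ∑-cong (upTo (suc m)) (λ j → trans (∑-*ˡ (upTo (suc p)) _ _) (∑-cong (upTo (suc p)) (λ j' →
           sym (trans (ι-× (lowCount γ ≟ j) _) (*-cong refl (ι-× (highCount γ ≟ j') (term? γ))))))) ⟩
        ∑ (upTo (suc m)) (λ j → ∑ (upTo (suc p)) (λ j' → ι (counted? γ j j'))) ∎
      where
      low? : Dec (restrict≤ m γ ≡.≡ σ)
      low? = restrict≤ m γ ≟w σ
      high? : Dec (std (restrict> m γ) ≡.≡ τ)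
      high? = std (restrict> m γ) ≟w τ

    ∑-filter-allPerms-Δcoeff : ∑ (filter Q? (allPerms n)) (λ γ → Δcoeff γ σ τ) ≈
      ∑ (upTo (suc m)) (λ j → ∑ (upTo (suc p)) (λ j' →
        ι (C? j j') * (Δcoeff α (std (take j σ)) (std (take j' τ)) * Δcoeff β (std (drop j σ)) (std (drop j' τ)))))
    ∑-filter-allPerms-Δcoeff = begin
        ∑ (filter Q? (allPerms n)) (λ γ → Δcoeff γ σ τ)
      ≈⟨ ∑-filter Q? (allPerms n) _ ⟩
        ∑ (allPerms n) (λ γ → ι (Q? γ) * Δcoeff γ σ τ)
      ≈⟨ ∑-cong-∈ (allPerms n) ι*Δcoeff≈∑counted ⟩
        ∑ (allPerms n) (λ γ → ∑ (upTo (suc m)) (λ j → ∑ (upTo (suc p)) (λ j' → ι (counted? γ j j'))))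
      ≈⟨ ∑-comm (allPerms n) (upTo (suc m)) _ ⟩
        ∑ (upTo (suc m)) (λ j → ∑ (allPerms n) (λ γ → ∑ (upTo (suc p)) (λ j' → ι (counted? γ j j'))))
      ≈⟨ ∑-cong (upTo (suc m)) (λ j → ∑-comm (allPerms n) (upTo (suc p)) _) ⟩
        ∑ (upTo (suc m)) (λ j → ∑ (upTo (suc p)) (λ j' → ∑ (allPerms n) (λ γ → ι (counted? γ j j'))))
      ≈⟨ ∑-cong-∈ (upTo (suc m)) (λ j∈ → ∑-cong-∈ (upTo (suc p)) (λ j'∈ →
           trans (∑-allPerms-counted (≤-pred (∈-upTo⁻ j∈)) (≤-pred (∈-upTo⁻ j'∈))) (*-cong refl (ι-compatible _ _ (≤-pred (∈-upTo⁻ j∈)))))) ⟩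
        ∑ (upTo (suc m)) (λ j → ∑ (upTo (suc p)) (λ j' →
          ι (C? j j') * (Δcoeff α (std (take j σ)) (std (take j' τ)) * Δcoeff β (std (drop j σ)) (std (drop j' τ))))) ∎

module Primitivity {c ℓ} (R : CommutativeRing c ℓ) where

  open Lists
  open Intervals
  open Enumeration
  open Sums R
  open Coefficients R
  open FQ R
  open CommutativeRing R renaming (Carrier to K)
  open import Level using (_⊔_)
  open import Relation.Binary.Reasoning.Setoid setoid
  open import Data.Nat using (ℕ; zero; suc; _≤_; _<_; z≤n; s≤s; _≟_)
  import Data.Nat as ℕ
  open import Data.Nat.Properties using (≤-refl; ≤-pred; ≤∧≢⇒<; ≤-trans; m≤m+n)
  open import Data.List using (List; []; length; take; drop; filter; upTo)
  open import Data.List.Properties using (take-all; drop-all)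
  open import Data.List.Membership.Propositional using (_∈_)
  open import Data.List.Membership.Propositional.Properties using (∈-filter⁻)
  import Data.List.Relation.Unary.All as All
  open All using (All)
  import Data.List.Relation.Unary.All.Properties as All
  open import Data.List.Membership.DecPropositional (_≟_) using (_∈?_)
  open import Data.List.Relation.Binary.Permutation.Propositional using (↭-sym)
  open import Data.List.Relation.Binary.Permutation.Propositional.Properties using (∈-resp-↭)
  open import Data.Product using (_×_; _,_; proj₁; proj₂)
  open import Data.Sum using (_⊎_; inj₁; inj₂)
  open import Function using (_∘_)
  open import Relation.Nullary using (Dec; yes; no; contradiction)
  open import Relation.Nullary.Decidable using (_×-dec_)
  import Relation.Unary
  open import Function.Bundles using (_⇔_)
  import Relation.Binary.PropositionalEquality as ≡
  open import Data.Empty using (⊥-elim)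

  private
    ≢[]-sym : ∀ {w : Word} → w ≡.≢ [] → [] ≡.≢ w
    ≢[]-sym w≢[] = w≢[] ∘ ≡.sym

  primCoeff-nonempty : ∀ γ {A B} → A ≡.≢ [] → B ≡.≢ [] → primCoeff γ A B ≈ 0#
  primCoeff-nonempty γ A≢[] B≢[] = trans (+-cong (*≈0ʳ (δ-≢ (≢[]-sym B≢[]))) (*≈0ˡ (δ-≢ (≢[]-sym A≢[])))) (+-identityˡ 0#)

  primCoeff-[]ˡ : ∀ {γ B} → γ ≡.≢ [] ⊎ B ≡.≢ [] → primCoeff γ [] B ≈ δ γ B
  primCoeff-[]ˡ {γ} {B} nonempty = trans (+-cong (vanish nonempty) (*-cong (δ-refl []) refl)) (trans (+-identityˡ _) (*-identityˡ _))
    where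
    vanish : γ ≡.≢ [] ⊎ B ≡.≢ [] → δ γ [] * δ [] B ≈ 0#
    vanish (inj₁ γ≢[]) = *≈0ˡ (δ-≢ γ≢[])
    vanish (inj₂ B≢[]) = *≈0ʳ (δ-≢ (≢[]-sym B≢[]))

  primCoeff-[]ʳ : ∀ {γ A} → γ ≡.≢ [] ⊎ A ≡.≢ [] → primCoeff γ A [] ≈ δ γ A
  primCoeff-[]ʳ {γ} {A} nonempty = trans (+-cong (*-cong refl (δ-refl [])) (vanish nonempty)) (trans (+-identityʳ _) (*-identityʳ _))
    where
    vanish : γ ≡.≢ [] ⊎ A ≡.≢ [] → δ [] A * δ γ [] ≈ 0#
    vanish (inj₁ γ≢[]) = *≈0ʳ (δ-≢ γ≢[])
    vanish (inj₂ A≢[]) = *≈0ˡ (δ-≢ (≢[]-sym A≢[]))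

  -- F A B plays the role of the coefficient of G_A ⊗ G_B in the coproduct of a primitive element, f A of G_A in the element.
  record PrimitiveCoefficients (F : Word → Word → K) (f : Word → K) : Set (c ⊔ ℓ) where
    field
      nonempty-nonempty : ∀ {A B} → A ≡.≢ [] → B ≡.≢ [] → F A B ≈ 0#
      nonempty-[] : ∀ {A} → A ≡.≢ [] → F A [] ≈ f A
      []-nonempty : ∀ {B} → B ≡.≢ [] → F [] B ≈ f B

  Δcoeffs : FQSym → Word → Word → K
  Δcoeffs x A B = linExt x (λ γ → Δcoeff γ A B)

  coeffs : FQSym → Word → K
  coeffs x A = linExt x (λ γ → δ γ A)

  primitiveCoefficients : ∀ x → Primitive x → PrimitiveCoefficients (Δcoeffs x) (coeffs x)
  primitiveCoefficients x prim-x = record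
    { nonempty-nonempty = λ A≢[] B≢[] → trans (as-primCoeff _ _) (∑-zero x (λ _ → *≈0ʳ (primCoeff-nonempty _ A≢[] B≢[])))
    ; nonempty-[] = λ A≢[] → trans (as-primCoeff _ _) (∑-cong x (λ _ → *-cong refl (primCoeff-[]ʳ (inj₂ A≢[]))))
    ; []-nonempty = λ B≢[] → trans (as-primCoeff _ _) (∑-cong x (λ _ → *-cong refl (primCoeff-[]ˡ (inj₂ B≢[]))))
    }
    where
    as-primCoeff : ∀ A B → Δcoeffs x A B ≈ linExt x (λ γ → primCoeff γ A B)
    as-primCoeff A B = trans (sym (coeff⊗-Δ x A B)) (trans (prim-x A B) (coeff⊗-⊗1+1⊗ x A B))

  ne? : (σ τ : Word) (j j' : ℕ) → Dec (1 ∈ take j σ × length τ ∈ drop j' τ)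
  ne? σ τ j j' = (1 ∈? take j σ) ×-dec (length τ ∈? drop j' τ)

  sw? : (σ τ : Word) (j j' : ℕ) → Dec (1 ∈ drop j σ × length τ ∈ take j' τ)
  sw? σ τ j j' = (1 ∈? drop j σ) ×-dec (length τ ∈? take j' τ)

  module Evaluation {σ τ : Word} (πσ : IsPerm σ) (πτ : IsPerm τ) (σ≢[] : σ ≡.≢ []) (τ≢[] : τ ≡.≢ [])
    {F G : Word → Word → K} {f g : Word → K} (PF : PrimitiveCoefficients F f) (PG : PrimitiveCoefficients G g) where

    open PrimitiveCoefficients

    private
      m p : ℕ
      m = length σ
      p = length τ

      1≤m : 1 ≤ m
      1≤m = ≢[]⇒1≤length σ σ≢[]

      1≤p : 1 ≤ p
      1≤p = ≢[]⇒1≤length τ τ≢[]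

      splitTerm : ∀ {r} {C : ℕ → ℕ → Set r} → (∀ j j' → Dec (C j j')) → ℕ → ℕ → K
      splitTerm C? j j' = ι (C? j j') * (F (std (take j σ)) (std (take j' τ)) * G (std (drop j σ)) (std (drop j' τ)))

      std-take-≢[] : ∀ {j} (w : Word) → 1 ≤ j → w ≡.≢ [] → std (take j w) ≡.≢ []
      std-take-≢[] w 1≤j w≢[] = map-≢[] _ (take-≢[] w 1≤j w≢[])

      std-drop-≢[] : ∀ {j} (w : Word) → j < length w → std (drop j w) ≡.≢ []
      std-drop-≢[] {j} w j< = map-≢[] _ (drop-≢[] j w j<)

      1∈σ : 1 ∈ σ
      1∈σ = ∈-resp-↭ (↭-sym πσ) (∈-one-to⁺ m ≤-refl 1≤m)

      p∈τ : p ∈ τ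
      p∈τ = ∈-resp-↭ (↭-sym πτ) (∈-one-to⁺ p 1≤p ≤-refl)

      std-σ : std σ ≡.≡ σ
      std-σ = std-perm σ πσ

      std-τ : std τ ≡.≡ τ
      std-τ = std-perm τ πτ

    -- only the splitting where σ stays left and τ goes right survives
    ∑-splitTerm-ne : ∑ (upTo (suc m)) (λ j → ∑ (upTo (suc p)) (splitTerm (ne? σ τ) j)) ≈ f σ * g τ
    ∑-splitTerm-ne = trans (∑-upTo²-single (suc m) (suc p) _ m 0 ≤-refl (s≤s z≤n) vanish) peak
      where
      vanish : ∀ j j' → j < suc m → j' < suc p → j ≡.≢ m ⊎ j' ≡.≢ 0 → splitTerm (ne? σ τ) j j' ≈ 0#
      vanish zero    j'       _  _   _ = *≈0ˡ (ι-no (ne? σ τ 0 j') (λ ()))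
      vanish (suc j) (suc j') j< j'< _ = *≈0ʳ (*≈0ˡ (nonempty-nonempty PF (std-take-≢[] σ (s≤s z≤n) σ≢[]) (std-take-≢[] τ (s≤s z≤n) τ≢[])))
      vanish (suc j) zero     j< _ (inj₁ j≢m) =
        *≈0ʳ (*≈0ʳ (nonempty-nonempty PG (std-drop-≢[] σ (≤∧≢⇒< (≤-pred j<) j≢m)) (std-drop-≢[] τ 1≤p)))
      vanish (suc j) zero     _  _ (inj₂ 0≢0) = ⊥-elim (0≢0 ≡.refl)
      peak : splitTerm (ne? σ τ) m 0 ≈ f σ * g τ
      peak = begin
          ι (ne? σ τ m 0) * (F (std (take m σ)) [] * G (std (drop m σ)) (std τ))
        ≈⟨ *-cong (ι-yes (ne? σ τ m 0) (≡.subst (1 ∈_) (≡.sym (take-all m σ ≤-refl)) 1∈σ , p∈τ)) refl ⟩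
          1# * (F (std (take m σ)) [] * G (std (drop m σ)) (std τ))
        ≡⟨ ≡.cong₂ (λ A B → 1# * (F A [] * G (std B) (std τ))) (≡.trans (≡.cong std (take-all m σ ≤-refl)) std-σ) (drop-all m σ ≤-refl) ⟩
          1# * (F σ [] * G [] (std τ))
        ≡⟨ ≡.cong (λ B → 1# * (F σ [] * G [] B)) std-τ ⟩
          1# * (F σ [] * G [] τ)
        ≈⟨ trans (*-identityˡ _) (*-cong (nonempty-[] PF σ≢[]) ([]-nonempty PG τ≢[])) ⟩
          f σ * g τ ∎

    -- only the splitting where σ goes right and τ stays left survives
    ∑-splitTerm-sw : ∑ (upTo (suc m)) (λ j → ∑ (upTo (suc p)) (splitTerm (sw? σ τ) j)) ≈ f τ * g σ
    ∑-splitTerm-sw = trans (∑-upTo²-single (suc m) (suc p) _ 0 p (s≤s z≤n) ≤-refl vanish) peak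
      where
      vanish : ∀ j j' → j < suc m → j' < suc p → j ≡.≢ 0 ⊎ j' ≡.≢ p → splitTerm (sw? σ τ) j j' ≈ 0#
      vanish j       zero     _  _   _ = *≈0ˡ (ι-no (sw? σ τ j 0) (λ ()))
      vanish (suc j) (suc j') j< j'< _ = *≈0ʳ (*≈0ˡ (nonempty-nonempty PF (std-take-≢[] σ (s≤s z≤n) σ≢[]) (std-take-≢[] τ (s≤s z≤n) τ≢[])))
      vanish zero    (suc j') _ j'< (inj₂ j'≢p) =
        *≈0ʳ (*≈0ʳ (nonempty-nonempty PG (std-drop-≢[] σ 1≤m) (std-drop-≢[] τ (≤∧≢⇒< (≤-pred j'<) j'≢p))))
      vanish zero    (suc j') _ _ (inj₁ 0≢0) = ⊥-elim (0≢0 ≡.refl)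
      peak : splitTerm (sw? σ τ) 0 p ≈ f τ * g σ
      peak = begin
          ι (sw? σ τ 0 p) * (F [] (std (take p τ)) * G (std σ) (std (drop p τ)))
        ≈⟨ *-cong (ι-yes (sw? σ τ 0 p) (1∈σ , ≡.subst (p ∈_) (≡.sym (take-all p τ ≤-refl)) p∈τ)) refl ⟩
          1# * (F [] (std (take p τ)) * G (std σ) (std (drop p τ)))
        ≡⟨ ≡.cong₂ (λ B A → 1# * (F [] B * G A (std (drop p τ)))) (≡.trans (≡.cong std (take-all p τ ≤-refl)) std-τ) std-σ ⟩
          1# * (F [] τ * G σ (std (drop p τ)))
        ≡⟨ ≡.cong (λ B → 1# * (F [] τ * G σ (std B))) (drop-all p τ ≤-refl) ⟩
          1# * (F [] τ * G σ [])
        ≈⟨ trans (*-identityˡ _) (*-cong ([]-nonempty PF τ≢[]) (nonempty-[] PG σ≢[])) ⟩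
          f τ * g σ ∎

  module _ {x y : FQSym} (wf-x : WellFormed x) (wf-y : WellFormed y) (prim-x : Primitive x) (prim-y : Primitive y)
    {σ τ : Word} (πσ : IsPerm σ) (πτ : IsPerm τ) (σ≢[] : σ ≡.≢ []) (τ≢[] : τ ≡.≢ []) where

    private
      m p : ℕ
      m = length σ
      p = length τ

      left right : Word → ℕ → ℕ → K
      left α j j' = Δcoeff α (std (take j σ)) (std (take j' τ))
      right β j j' = Δcoeff β (std (drop j σ)) (std (drop j' τ))

      Δcoeffs-left Δcoeffs-right : ℕ → ℕ → K
      Δcoeffs-left j j' = Δcoeffs x (std (take j σ)) (std (take j' τ))
      Δcoeffs-right j j' = Δcoeffs y (std (drop j σ)) (std (drop j' τ))

      module E = Evaluation πσ πτ σ≢[] τ≢[] (primitiveCoefficients x prim-x) (primitiveCoefficients y prim-y)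

      Δcoeffs-restricted : ∀ {q r} {Q : Word → Word → Word → Set q} (Q? : ∀ α β → Relation.Unary.Decidable (Q α β))
        (Q⇒InStar : ∀ {α β γ} → Q α β γ → InStar α β γ) {C : ℕ → ℕ → Set r} (C? : ∀ j j' → Dec (C j j')) →
        (∀ {α β} (πα : IsPerm α) (πβ : IsPerm β) {j j'} → j ≤ m → j' ≤ p → Unshuffle.Compatible α β σ τ πα πβ πσ πτ j j' →
          Q α β (Unshuffle.candidate α β σ τ πα πβ πσ πτ j j') ⇔ C j j') →
        Δcoeffs (bilin (λ α β → filter (Q? α β) (allPerms (length α ℕ.+ length β))) x y) σ τ ≈
        ∑ (upTo (suc m)) (λ j → ∑ (upTo (suc p)) (λ j' → ι (C? j j') * (Δcoeffs-left j j' * Δcoeffs-right j j')))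
      Δcoeffs-restricted Q? Q⇒InStar C? Q⇔C = begin
          Δcoeffs (bilin words x y) σ τ
        ≈⟨ linExt-bilin words x y _ ⟩
          ∑ x (λ s → ∑ y (λ t → (proj₁ s * proj₁ t) * ∑ (words (proj₂ s) (proj₂ t)) (λ γ → Δcoeff γ σ τ)))
        ≈⟨ ∑-cong-∈ x (λ s∈ → ∑-cong-∈ y (λ t∈ → *-cong refl
             (Counting.∑-filter-allPerms-Δcoeff R _ _ σ τ (All.lookup wf-x s∈) (All.lookup wf-y t∈) πσ πτ (Q? _ _) Q⇒InStar C?
               (Q⇔C (All.lookup wf-x s∈) (All.lookup wf-y t∈))))) ⟩
          ∑ x (λ s → ∑ y (λ t → (proj₁ s * proj₁ t) * ∑ (upTo (suc m)) (λ j → ∑ (upTo (suc p)) (λ j' →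
            ι (C? j j') * (left (proj₂ s) j j' * right (proj₂ t) j j')))))
        ≈⟨ ∑²-bilinear x y (upTo (suc m)) (upTo (suc p)) (λ j j' → ι (C? j j')) left right ⟩
          ∑ (upTo (suc m)) (λ j → ∑ (upTo (suc p)) (λ j' → ι (C? j j') * (Δcoeffs-left j j' * Δcoeffs-right j j'))) ∎
        where
        words : Word → Word → List Word
        words α β = filter (Q? α β) (allPerms (length α ℕ.+ length β))

    ↗-Δcoeffs : Δcoeffs (x ↗ y) σ τ ≈ coeffs x σ * coeffs y τ
    ↗-Δcoeffs = trans (Δcoeffs-restricted inNE? proj₁ (ne? σ τ) (λ πα πβ j≤m j'≤p compatible →
        Unshuffle.Candidate.InNE-candidate _ _ σ τ πα πβ πσ πτ j≤m j'≤p compatible (≢[]⇒1≤length σ σ≢[]) (≢[]⇒1≤length τ τ≢[])))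
      E.∑-splitTerm-ne

    ↙-Δcoeffs : Δcoeffs (x ↙ y) σ τ ≈ coeffs x τ * coeffs y σ
    ↙-Δcoeffs = trans (Δcoeffs-restricted inSW? proj₁ (sw? σ τ) (λ πα πβ j≤m j'≤p compatible →
        Unshuffle.Candidate.InSW-candidate _ _ σ τ πα πβ πσ πτ j≤m j'≤p compatible (≢[]⇒1≤length σ σ≢[]) (≢[]⇒1≤length τ τ≢[])))
      E.∑-splitTerm-sw

  NonemptyPerm : Word → Set
  NonemptyPerm γ = IsPerm γ × γ ≡.≢ []

  filter-allPerms-NonemptyPerm : ∀ {q} {Q : Word → Set q} (Q? : Relation.Unary.Decidable Q) {n} → 1 ≤ n →
    All NonemptyPerm (filter Q? (allPerms n))
  filter-allPerms-NonemptyPerm Q? {n} 1≤n = All.tabulate λ γ∈ → let γ∈allPerms = proj₁ (∈-filter⁻ Q? {xs = allPerms n} γ∈) in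
    allPerms-IsPerm {n} γ∈allPerms , λ { ≡.refl → contradiction (≡.subst (1 ≤_) (≡.sym (length-↭-one-to (allPerms-↭ n γ∈allPerms))) 1≤n) λ () }

  module Bracket {x y : FQSym} (wf-x : WellFormed x) (wf-y : WellFormed y) (pos-x : PositiveDegree x) (pos-y : PositiveDegree y)
    (prim-x : Primitive x) (prim-y : Primitive y) where

    z : FQSym
    z = (x ↗ y) − (y ↙ x)

    private
      z-NonemptyPerm : All (NonemptyPerm ∘ proj₂) z
      z-NonemptyPerm = All-− (All-bilin neWords {x} {y} (λ {s} s∈ _ → filter-allPerms-NonemptyPerm _ (≤-trans (All.lookup pos-x s∈) (m≤m+n _ _))))
                             (All-bilin swWords {y} {x} (λ {s} s∈ _ → filter-allPerms-NonemptyPerm _ (≤-trans (All.lookup pos-y s∈) (m≤m+n _ _))))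

      Δcoeffs-z-nonempty : ∀ {σ τ} → σ ≡.≢ [] → τ ≡.≢ [] → Dec (IsPerm σ) → Dec (IsPerm τ) → Δcoeffs z σ τ ≈ 0#
      Δcoeffs-z-nonempty σ≢[] τ≢[] (yes πσ) (yes πτ) = begin
          Δcoeffs z _ _
        ≈⟨ linExt-− (x ↗ y) (y ↙ x) _ ⟩
          Δcoeffs (x ↗ y) _ _ - Δcoeffs (y ↙ x) _ _
        ≈⟨ +-cong (↗-Δcoeffs wf-x wf-y prim-x prim-y πσ πτ σ≢[] τ≢[]) (-‿cong (↙-Δcoeffs wf-y wf-x prim-y prim-x πσ πτ σ≢[] τ≢[])) ⟩
          coeffs x _ * coeffs y _ - coeffs y _ * coeffs x _
        ≈⟨ +-cong (*-comm _ _) refl ⟩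
          coeffs y _ * coeffs x _ - coeffs y _ * coeffs x _
        ≈⟨ -‿inverseʳ _ ⟩
          0# ∎
      Δcoeffs-z-nonempty {σ} {τ} _ _ (no ¬πσ) _ =
        trans (linExt-cong-All z-NonemptyPerm (λ (πγ , _) → Δcoeff-¬perm πγ σ τ (¬πσ ∘ proj₁))) (∑-zero z (λ _ → zeroʳ _))
      Δcoeffs-z-nonempty {σ} {τ} _ _ (yes _) (no ¬πτ) =
        trans (linExt-cong-All z-NonemptyPerm (λ (πγ , _) → Δcoeff-¬perm πγ σ τ (¬πτ ∘ proj₂))) (∑-zero z (λ _ → zeroʳ _))

    Δcoeffs≈primCoeffs : ∀ σ τ → Δcoeffs z σ τ ≈ linExt z (λ γ → primCoeff γ σ τ)
    Δcoeffs≈primCoeffs σ τ with σ ≟w [] | τ ≟w []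
    ... | yes ≡.refl | _ = linExt-cong-All z-NonemptyPerm (λ (πγ , γ≢[]) → trans (Δcoeff-[]ˡ πγ τ) (sym (primCoeff-[]ˡ (inj₁ γ≢[]))))
    ... | no _ | yes ≡.refl = linExt-cong-All z-NonemptyPerm (λ (πγ , γ≢[]) → trans (Δcoeff-[]ʳ πγ σ) (sym (primCoeff-[]ʳ (inj₁ γ≢[]))))
    ... | no σ≢[] | no τ≢[] = trans (Δcoeffs-z-nonempty σ≢[] τ≢[] (isPerm? σ) (isPerm? τ))
                                    (sym (∑-zero z (λ _ → *≈0ʳ (primCoeff-nonempty _ σ≢[] τ≢[]))))

mainTheorem2 : ∀ {c ℓ} (R : CommutativeRing c ℓ) → let open FQ R in
    (x y : FQSym) → WellFormed x → WellFormed y →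
    PositiveDegree x → PositiveDegree y →
    Primitive x → Primitive y →
    Primitive ((x ↗ y) − (y ↙ x))
mainTheorem2 R x y wf-x wf-y pos-x pos-y prim-x prim-y σ τ = begin
    coeff⊗ (Δ z) σ τ
  ≈⟨ coeff⊗-Δ z σ τ ⟩
    linExt z (λ γ → Δcoeff γ σ τ)
  ≈⟨ Δcoeffs≈primCoeffs σ τ ⟩
    linExt z (λ γ → primCoeff γ σ τ)
  ≈⟨ sym (coeff⊗-⊗1+1⊗ z σ τ) ⟩
    coeff⊗ (⊗1+1⊗ z) σ τ ∎
  where
  open FQ R
  open CommutativeRing R using (setoid; sym)
  open import Relation.Binary.Reasoning.Setoid setoid
  open Coefficients R
  open Primitivity.Bracket R wf-x wf-y pos-x pos-y prim-x prim-y
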